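{- For a Dyck path $d$ of semilength $n$, the decreasing permutation $\delta_n = n(n-1)\cdots 1$ lies in $M_d$ if and only if $\mathrm{pk}(d)=\mathrm{bpk}(d)$. Moreover, the generating function $\sum_{n\ge 0} a_n x^n$, where $a_n$ is the number of Dyck paths $d$ of semilength $n$ with $\mathrm{pk}(d)=\mathrm{bpk}(d)$ (with $a_0=1$ for the empty path), equals $\frac{1-2x}{1-3x+x^2}$.
   Context: A Dyck path of semilength $n$ is a lattice path from $(0,0)$ to $(2n,0)$ with steps $U=(1,1)$ and $D=(1,-1)$ never going below the $x$-axis. A peak is an occurrence of $UD$; $\mathrm{pk}(d)$ is the number of peaks of $d$. The bounce path of $d$: start at $(0,0)$, take up-steps until reaching a point of $d$ where $d$'s next step is a down-step, then take down-steps to the $x$-axis, then up-steps until again meeting a down-step of $d$, and so on until $(2n,0)$; $\mathrm{bpk}(d)$ is its number of peaks. For $\sigma=\sigma_1\cdots\sigma_n\in\mathfrak{S}_n$, $\mathrm{can}(d,\sigma)$ is the word of length $2n$ obtained by labeling the $i$-th up-step and the $i$-th down-step of $d$ with $\sigma_i$ and reading left to right; $\mathrm{des}(d,\sigma)$ is the number of $j\in[2n-1]$ with $\mathrm{can}(d,\sigma)_j>\mathrm{can}(d,\sigma)_{j+1}$. $m_d=\max_{\sigma\in\mathfrak{S}_n}\mathrm{des}(d,\sigma)$ and $M_d=\{\sigma\in\mathfrak{S}_n \mid \mathrm{des}(d,\sigma)=m_d\}$. -}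

module Defs where

open import Data.Bool using (Bool; true; false; if_then_else_; _∧_)
open import Data.Nat using (ℕ; zero; suc; _+_; _*_; _∸_; _<?_; _≤ᵇ_; _<ᵇ_)
open import Data.Nat.Properties using ()
open import Data.Integer as ℤ using (ℤ; +_; -[1+_])
open import Data.Maybe using (Maybe; just; nothing)
open import Data.List using (List; []; _∷_; _++_; length; replicate; take; drop; filter; map)
open import Data.Fin using (Fin; toℕ; fromℕ<; opposite)
open import Data.Fin.Properties using (opposite-involutive)
open import Data.Fin.Permutation using (Permutation′; permutation; _⟨$⟩ʳ_)
open import Data.Product using (_×_)
open import Relation.Nullary using (yes; no; Dec)
open import Relation.Nullary.Decidable using (_×-dec_)
open import Relation.Binary.PropositionalEquality using (_≡_)
import Data.Maybe.Properties as MP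
import Data.Nat as ℕ

-- Steps: true = U = (1,1), false = D = (1,-1).

Step : Set
Step = Bool

walk : ℕ → List Step → Maybe ℕ
walk h []            = just h
walk h (true  ∷ w)   = walk (suc h) w
walk zero (false ∷ w) = nothing
walk (suc h) (false ∷ w) = walk h w

IsDyck : List Step → Set
IsDyck w = walk 0 w ≡ just 0

isDyck? : (w : List Step) → Dec (IsDyck w)
isDyck? w = MP.≡-dec ℕ._≟_ (walk 0 w) (just 0)

record DyckPath (n : ℕ) : Set where
  constructor dyck
  field
    steps  : List Step
    len    : length steps ≡ 2 * n
    dyckOK : IsDyck steps
open DyckPath public

peaks : List Step → ℕ
peaks []                    = 0
peaks (true ∷ false ∷ w)    = suc (peaks (false ∷ w))
peaks (_ ∷ w)               = peaks w

count : Bool → List Step → ℕ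
count b []      = 0
count true  (true ∷ w)  = suc (count true w)
count true  (false ∷ w) = count true w
count false (false ∷ w) = suc (count false w)
count false (true ∷ w)  = count false w

height : List Step → ℕ → ℤ
height w x = + count true (take x w) ℤ.- + count false (take x w)

downAt : List Step → ℕ → Bool
downAt w x with drop x w
... | false ∷ _ = true
... | _         = false

eqℤ : ℤ → ℤ → Bool
eqℤ a b with a ℤ.≟ b
... | yes _ = true
... | no  _ = false

-- smallest j ≥ j₀ (searching at most `fuel` values) such that the point
-- (x0 + j , j) lies on w and the next step of w there is a down-step.
search : List Step → ℕ → ℕ → ℕ → ℕ
search w zero     x0 j = 0
search w (suc f)  x0 j =
  if eqℤ (height w (x0 + j)) (+ j) ∧ downAt w (x0 + j)
  then j else search w f x0 (suc j)

bounceFrom : List Step → ℕ → ℕ → List Step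
bounceFrom w zero    x0 = []
bounceFrom w (suc f) x0 =
  if length w ≤ᵇ x0 then []
  else (let j = search w (length w) x0 1 in
        replicate j true ++ replicate j false ++ bounceFrom w f (x0 + 2 * j))

bounce : List Step → List Step
bounce w = bounceFrom w (length w) 0

pk : ∀ {n} → DyckPath n → ℕ
pk d = peaks (steps d)

bpk : ∀ {n} → DyckPath n → ℕ
bpk d = peaks (bounce (steps d))

-- σ as a function on 0-based positions (values toℕ, i.e. shifted by -1,
-- which does not affect descents).
label : ∀ {n} → Permutation′ n → ℕ → ℕ
label {n} σ i with i <? n
... | yes p = toℕ (σ ⟨$⟩ʳ fromℕ< p)
... | no  _ = 0

canAux : (ℕ → ℕ) → ℕ → ℕ → List Step → List ℕ
canAux f u dn []          = []
canAux f u dn (true ∷ w)  = f u  ∷ canAux f (suc u) dn w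
canAux f u dn (false ∷ w) = f dn ∷ canAux f u (suc dn) w

can : ∀ {n} → DyckPath n → Permutation′ n → List ℕ
can d σ = canAux (label σ) 0 0 (steps d)

descents : List ℕ → ℕ
descents []           = 0
descents (a ∷ [])     = 0
descents (a ∷ b ∷ w)  = (if b <ᵇ a then 1 else 0) + descents (b ∷ w)

des : ∀ {n} → DyckPath n → Permutation′ n → ℕ
des d σ = descents (can d σ)

δ : (n : ℕ) → Permutation′ n
δ n = permutation opposite opposite opposite-involutive opposite-involutive

-- δ_n ∈ M_d : δ_n attains the maximum m_d of des(d, -) over 𝔖_n
InM : ∀ {n} → DyckPath n → Permutation′ n → Set
InM {n} d τ = ∀ (σ : Permutation′ n) → des d σ ℕ.≤ des d τ

words : ℕ → List (List Step)
words zero    = [] ∷ []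
words (suc k) = map (true ∷_) (words k) ++ map (false ∷_) (words k)

Good : List Step → Set
Good w = IsDyck w × peaks w ≡ peaks (bounce w)

good? : (w : List Step) → Dec (Good w)
good? w = isDyck? w ×-dec (peaks w ℕ.≟ peaks (bounce w))

a : ℕ → ℕ
a n = length (filter good? (words (2 * n)))

-- Formal power series over ℤ as coefficient sequences.

sumTo : ℕ → (ℕ → ℤ) → ℤ
sumTo zero    f = f 0
sumTo (suc n) f = sumTo n f ℤ.+ f (suc n)

conv : (ℕ → ℤ) → (ℕ → ℤ) → ℕ → ℤ
conv f g n = sumTo n (λ k → f k ℤ.* g (n ∸ k))

den : ℕ → ℤ
den 0 = + 1
den 1 = ℤ.- (+ 3)
den 2 = + 1
den _ = + 0

num : ℕ → ℤ
num 0 = + 1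
num 1 = ℤ.- (+ 2)
num _ = + 0

-- A bounce block of d runs from an up-step to the down-step carrying the same label, so its labels
-- cannot all descend: des(d, σ) + bpk(d) ≤ 2n − 1 for every σ.  For δ_n the non-descents are exactly
-- the peaks, so des(d, δ_n) + pk(d) = 2n − 1, and δ_n ∈ M_d when pk = bpk.
-- Conversely, pk = bpk means that no bounce block has two peaks.  An automaton tracking the bounce
-- path finds the first block, starting at up-step E say, with two peaks; keeping the indices below E
-- and those from E on in their natural orders and merging the two chains gives σ with
-- des(d, σ) + pk(d) ≥ 2n.  The same automaton counts the paths with pk = bpk: a_n = F_{2n−1}
-- (Fibonacci numbers, F_{−1} = 1), whose generating function is (1 − 2x)/(1 − 3x + x²).
module Submission where

open import Defs
open import Data.Nat using (ℕ)
open import Data.Integer using (+_)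
open import Data.Product using (_×_)
open import Function.Bundles using (_⇔_)
open import Relation.Binary.PropositionalEquality using (_≡_)

open import Data.Bool using (Bool; true; false; if_then_else_; _∧_)
import Data.Bool.Properties as Bool
open import Data.Empty using (⊥; ⊥-elim)
open import Data.Fin using (Fin; toℕ; fromℕ<; opposite; punchOut)
import Data.Fin.Properties as Fin
open import Data.Fin.Permutation using (Permutation′; permutation; _⟨$⟩ʳ_)
open import Data.Integer as ℤ using (ℤ)
import Data.Integer.Properties as ℤ
import Data.Integer.Tactic.RingSolver as ℤ-Solver
open import Data.List using (List; []; _∷_; _++_; length; replicate; take; drop; filter; map)
open import Data.List.Properties using (filter-++; filter-none; filter-≐; length-++)
open import Data.List.Relation.Unary.All as All using (All; []; _∷_)
open import Data.List.Relation.Unary.All.Properties using (++⁺; map⁺)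
open import Data.Maybe using (just)
open import Data.Nat using (zero; suc; _+_; _*_; _∸_; _≤_; _<_; z≤n; s≤s; _<ᵇ_; _≟_; _≤?_; _<?_)
open import Data.Nat.Properties
open import Data.Nat.Tactic.RingSolver using (solve-∀)
open import Data.Product using (∃; ∃₂; _,_; proj₁; proj₂)
open import Data.Product.Relation.Binary.Lex.Strict using (×-strictTotalOrder)
open import Data.Product.Relation.Binary.Pointwise.NonDependent using (≡×≡⇒≡)
open import Data.Sum using (_⊎_; inj₁; inj₂)
open import Data.Unit using (tt)
open import Function using (_∘_)
open import Function.Bundles using (mk⇔)
open import Relation.Binary using (StrictTotalOrder; tri<; tri≈; tri>)
open import Relation.Binary.PropositionalEquality
  using (refl; sym; trans; cong; cong₂; subst; subst₂; _≢_; module ≡-Reasoning)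
open import Relation.Nullary using (¬_; Dec; yes; no; does; contradiction)
open import Relation.Nullary.Decidable using (dec-true; dec-false)
open import Relation.Unary using (Decidable; _≐_)

-- does (m <? n) and does (m ≤? n) compute to m <ᵇ n and m ≤ᵇ n, so these also evaluate the
-- boolean tests in Defs.
if-yes : ∀ {P A : Set} (P? : Dec P) {x y : A} → P → (if does P? then x else y) ≡ x
if-yes P? p rewrite dec-true P? p = refl

if-no : ∀ {P A : Set} (P? : Dec P) {x y : A} → ¬ P → (if does P? then x else y) ≡ y
if-no P? ¬p rewrite dec-false P? ¬p = refl

double : ∀ m → 2 * m ≡ m + m
double m = cong (λ x → m + x) (+-identityʳ m)

ups downs : List Step → ℕ
ups   = count true
downs = count false

walk-balance : ∀ h w {z} → walk h w ≡ just z → h + ups w ≡ z + downs w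
walk-balance h       []          refl = refl
walk-balance h       (true ∷ w)  e    = trans (+-suc h (ups w)) (walk-balance (suc h) w e)
walk-balance (suc h) (false ∷ w) {z} e = trans (cong suc (walk-balance h w e)) (sym (+-suc z (downs w)))

length≡ups+downs : ∀ w → length w ≡ ups w + downs w
length≡ups+downs []          = refl
length≡ups+downs (true ∷ w)  = cong suc (length≡ups+downs w)
length≡ups+downs (false ∷ w) = trans (cong suc (length≡ups+downs w)) (sym (+-suc (ups w) (downs w)))

downs≡semilength : ∀ {n} (d : DyckPath n) → downs (steps d) ≡ n
downs≡semilength {n} d = *-cancelˡ-≡ (downs w) n 2 (begin
  2 * downs w         ≡⟨ double (downs w) ⟩
  downs w + downs w   ≡⟨ cong (_+ downs w) (sym (walk-balance 0 w (dyckOK d))) ⟩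
  ups w + downs w     ≡⟨ sym (length≡ups+downs w) ⟩
  length w            ≡⟨ len d ⟩
  2 * n               ∎)
  where
  open ≡-Reasoning
  w = steps d

-- upsBefore w k: the number of up-steps of w before its k-th down-step, counting from 0.
upsBefore : List Step → ℕ → ℕ
upsBefore []          _       = 0
upsBefore (true ∷ w)  k       = suc (upsBefore w k)
upsBefore (false ∷ w) zero    = 0
upsBefore (false ∷ w) (suc k) = upsBefore w k

downsBefore : List Step → ℕ → ℕ
downsBefore []          _       = 0
downsBefore (false ∷ w) k       = suc (downsBefore w k)
downsBefore (true ∷ w)  zero    = 0
downsBefore (true ∷ w)  (suc k) = downsBefore w k

downsBefore-mono : ∀ w {i j} → i ≤ j → downsBefore w i ≤ downsBefore w j
downsBefore-mono []          _         = z≤n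
downsBefore-mono (false ∷ w) i≤j       = s≤s (downsBefore-mono w i≤j)
downsBefore-mono (true ∷ w)  z≤n       = z≤n
downsBefore-mono (true ∷ w)  (s≤s i≤j) = downsBefore-mono w i≤j

prefix-length : ∀ p w {x : Step} {r} → drop p w ≡ x ∷ r → ups (take p w) + downs (take p w) ≡ p
prefix-length zero    _           _ = refl
prefix-length (suc p) (true ∷ w)  d = cong suc (prefix-length p w d)
prefix-length (suc p) (false ∷ w) d = trans (+-suc _ _) (cong suc (prefix-length p w d))

drop≡∷⇒< : ∀ p w {x : Step} {r} → drop p w ≡ x ∷ r → p < length w
drop≡∷⇒< zero    (_ ∷ _) _ = s≤s z≤n
drop≡∷⇒< (suc p) (_ ∷ w) d = s≤s (drop≡∷⇒< p w d)

upsBefore-at : ∀ p w {r} → drop p w ≡ false ∷ r → upsBefore w (downs (take p w)) ≡ ups (take p w)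
upsBefore-at zero    (false ∷ _) _ = refl
upsBefore-at (suc p) (true ∷ w)  d = cong suc (upsBefore-at p w d)
upsBefore-at (suc p) (false ∷ w) d = upsBefore-at p w d

down-below-ups : ∀ p h w {z r} → walk h w ≡ just z → drop p w ≡ false ∷ r →
                 downs (take p w) < h + ups (take p w)
down-below-ups zero    (suc h) (false ∷ _) _ _ = s≤s z≤n
down-below-ups (suc p) h       (true ∷ w)  e d =
  subst (downs (take p w) <_) (sym (+-suc h _)) (down-below-ups p (suc h) w e d)
down-below-ups (suc p) (suc h) (false ∷ w) e d = s≤s (down-below-ups p h w e d)

down-position : ∀ w s → s < downs w → ∃₂ λ p r → downs (take p w) ≡ s × drop p w ≡ false ∷ r
down-position (true ∷ w)  s       lt = let p , r , e , d = down-position w s lt in suc p , r , e , d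
down-position (false ∷ w) zero    _  = zero , w , refl , refl
down-position (false ∷ w) (suc s) (s≤s lt) =
  let p , r , e , d = down-position w s lt in suc p , r , cong suc e , d

-- The bounce path

∧-true : ∀ {a b} → (a ∧ b) ≡ true → a ≡ true × b ≡ true
∧-true {true} {true} refl = refl , refl

eqℤ⇒≡ : ∀ {a b} → eqℤ a b ≡ true → a ≡ b
eqℤ⇒≡ {a} {b} e with a ℤ.≟ b
... | yes a≡b = a≡b

eqℤ-refl : ∀ a → eqℤ a a ≡ true
eqℤ-refl a with a ℤ.≟ a
... | yes _ = refl
... | no a≢a = contradiction refl a≢a

downAt⇒ : ∀ w p → downAt w p ≡ true → ∃ λ r → drop p w ≡ false ∷ r
downAt⇒ w p e with drop p w
... | false ∷ r = r , refl

⇒downAt : ∀ w p {r} → drop p w ≡ false ∷ r → downAt w p ≡ true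
⇒downAt w p d with drop p w
⇒downAt w p refl | _ = refl

height-at : ∀ w p → height w p ≡ ups (take p w) ℤ.⊖ downs (take p w)
height-at w p = ℤ.m-n≡m⊖n (ups (take p w)) (downs (take p w))

-- The test made by search: the bounce path leaving the axis at x0 turns down at height j.
turnsAt : List Step → ℕ → ℕ → Bool
turnsAt w x0 j = eqℤ (height w (x0 + j)) (+ j) ∧ downAt w (x0 + j)

search-finds : ∀ w f x0 j J → (∀ i → turnsAt w x0 i ≡ true → i ≡ J) → turnsAt w x0 J ≡ true →
               j ≤ J → J < j + f → search w f x0 j ≡ J
search-finds w zero    x0 j J _      _     j≤J J<j+0 = contradiction (subst (J <_) (+-identityʳ j) J<j+0) (≤⇒≯ j≤J)
search-finds w (suc f) x0 j J unique found j≤J J<j+f with turnsAt w x0 j in turns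
... | true  = unique j turns
... | false = search-finds w f x0 (suc j) J unique found (≤∧≢⇒< j≤J j≢J) (subst (J <_) (+-suc j f) J<j+f)
  where
  j≢J : j ≢ J
  j≢J refl with () ← trans (sym turns) found

data Bounces (n : ℕ) (g : ℕ → ℕ) : ℕ → ℕ → Set where
  stop : ∀ {s} → n ≤ s → Bounces n g s 0
  hop  : ∀ {s k} → s < n → Bounces n g (g s) k → Bounces n g s (suc k)

peaks-downs : ∀ k r → peaks (replicate k false ++ r) ≡ peaks r
peaks-downs zero    r = refl
peaks-downs (suc k) r = peaks-downs k r

peaks-ups : ∀ k r → peaks (replicate (suc k) true ++ false ∷ r) ≡ suc (peaks (false ∷ r))
peaks-ups zero    r = refl
peaks-ups (suc k) r = peaks-ups k r

tent : ℕ → List Step → List Step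
tent j r = replicate j true ++ replicate j false ++ r

peaks-tent : ∀ {j} r → 0 < j → peaks (tent j r) ≡ suc (peaks r)
peaks-tent {suc k} r _ = trans (peaks-ups k _) (cong suc (peaks-downs (suc k) r))

bounceFrom-end : ∀ w f x0 → length w ≤ x0 → bounceFrom w (suc f) x0 ≡ []
bounceFrom-end w f x0 = if-yes (length w ≤? x0)

bounceFrom-step : ∀ w f x0 → x0 < length w →
                  bounceFrom w (suc f) x0 ≡ tent (search w (length w) x0 1)
                                                 (bounceFrom w f (x0 + 2 * search w (length w) x0 1))
bounceFrom-step w f x0 lt = if-no (length w ≤? x0) (<⇒≱ lt)

-- The bounce path leaving the axis at 2s turns down at height g s ∸ s, where the s-th down-step of w
-- starts, and is back on the axis at 2 · g s; so its peaks are counted by Bounces n g.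
module BouncePath (w : List Step) (isDyck : IsDyck w) where
  n : ℕ
  n = downs w

  g : ℕ → ℕ
  g = upsBefore w

  length≡n+n : length w ≡ n + n
  length≡n+n = trans (length≡ups+downs w) (cong (_+ n) (walk-balance 0 w isDyck))

  turnsAt⇒bounce : ∀ s j → turnsAt w (2 * s) j ≡ true → j ≡ g s ∸ s × 2 * s + j < length w
  turnsAt⇒bounce s j turns = j≡ , drop≡∷⇒< p w d
    where
    open ≡-Reasoning
    p = 2 * s + j
    U = ups (take p w)
    D = downs (take p w)
    d = proj₂ (downAt⇒ w p (proj₂ (∧-true turns)))
    D≤U : D ≤ U
    D≤U = <⇒≤ (down-below-ups p 0 w isDyck d)
    U≡D+j : U ≡ D + j
    U≡D+j = begin
      U           ≡⟨ sym (m+[n∸m]≡n D≤U) ⟩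
      D + (U ∸ D) ≡⟨ cong (λ x → D + x) (ℤ.+-injective height≡j) ⟩
      D + j       ∎
      where
      height≡j : + (U ∸ D) ≡ + j
      height≡j = trans (sym (ℤ.⊖-≥ D≤U)) (trans (sym (height-at w p)) (eqℤ⇒≡ (proj₁ (∧-true turns))))
    D≡s : D ≡ s
    D≡s = *-cancelˡ-≡ D s 2 (+-cancelʳ-≡ j (2 * D) (2 * s) (begin
      2 * D + j       ≡⟨ cong (_+ j) (double D) ⟩
      D + D + j       ≡⟨ +-assoc D D j ⟩
      D + (D + j)     ≡⟨ cong (λ x → D + x) (sym U≡D+j) ⟩
      D + U           ≡⟨ +-comm D U ⟩
      U + D           ≡⟨ prefix-length p w d ⟩
      2 * s + j       ∎))
    j≡ : j ≡ g s ∸ s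
    j≡ = begin
      j               ≡⟨ sym (m+n∸m≡n s j) ⟩
      s + j ∸ s       ≡⟨ cong (λ x → x + j ∸ s) (sym D≡s) ⟩
      D + j ∸ s       ≡⟨ cong (_∸ s) (sym U≡D+j) ⟩
      U ∸ s           ≡⟨ cong (_∸ s) (sym (upsBefore-at p w d)) ⟩
      g D ∸ s         ≡⟨ cong (λ x → g x ∸ s) D≡s ⟩
      g s ∸ s         ∎

  turnsAt-down : ∀ p {r} → drop p w ≡ false ∷ r →
                 turnsAt w (2 * downs (take p w)) (ups (take p w) ∸ downs (take p w)) ≡ true
  turnsAt-down p d = subst (λ q → eqℤ (height w q) (+ (U ∸ D)) ∧ downAt w q ≡ true) (sym position)
                           (cong₂ _∧_ height-ok (⇒downAt w p d))
    where
    open ≡-Reasoning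
    U = ups (take p w)
    D = downs (take p w)
    D≤U : D ≤ U
    D≤U = <⇒≤ (down-below-ups p 0 w isDyck d)
    position : 2 * D + (U ∸ D) ≡ p
    position = begin
      2 * D + (U ∸ D)   ≡⟨ cong (_+ (U ∸ D)) (double D) ⟩
      D + D + (U ∸ D)   ≡⟨ +-assoc D D (U ∸ D) ⟩
      D + (D + (U ∸ D)) ≡⟨ cong (λ x → D + x) (m+[n∸m]≡n D≤U) ⟩
      D + U             ≡⟨ +-comm D U ⟩
      U + D             ≡⟨ prefix-length p w d ⟩
      p                 ∎
    height-ok : eqℤ (height w p) (+ (U ∸ D)) ≡ true
    height-ok = subst (λ z → eqℤ z (+ (U ∸ D)) ≡ true)
                      (sym (trans (height-at w p) (ℤ.⊖-≥ D≤U))) (eqℤ-refl _)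

  g-expanding : ∀ s → s < n → s < g s
  g-expanding s s<n with down-position w s s<n
  ... | p , r , refl , d = subst (s <_) (sym (upsBefore-at p w d)) (down-below-ups p 0 w isDyck d)

  turnsAt-bounce : ∀ s → s < n → turnsAt w (2 * s) (g s ∸ s) ≡ true
  turnsAt-bounce s s<n with down-position w s s<n
  ... | p , r , refl , d rewrite upsBefore-at p w d = turnsAt-down p d

  search-bounce : ∀ s → s < n → search w (length w) (2 * s) 1 ≡ g s ∸ s
  search-bounce s s<n =
    search-finds w (length w) (2 * s) 1 (g s ∸ s) (λ i t → proj₁ (turnsAt⇒bounce s i t)) found
                 (m<n⇒0<n∸m (g-expanding s s<n))
                 (s≤s (≤-trans (m≤n+m _ (2 * s)) (<⇒≤ (proj₂ (turnsAt⇒bounce s _ found)))))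
    where
    found = turnsAt-bounce s s<n

  2s<length : ∀ s → s < n → 2 * s < length w
  2s<length s s<n = subst₂ _<_ (sym (double s)) (sym length≡n+n) (+-mono-< s<n s<n)

  bounceFrom-hop : ∀ f s → s < n → peaks (bounceFrom w (suc f) (2 * s)) ≡ suc (peaks (bounceFrom w f (2 * g s)))
  bounceFrom-hop f s s<n = begin
    peaks (bounceFrom w (suc f) (2 * s))
      ≡⟨ cong peaks (bounceFrom-step w f (2 * s) (2s<length s s<n)) ⟩
    peaks (tent (search w (length w) (2 * s) 1) (bounceFrom w f (2 * s + 2 * search w (length w) (2 * s) 1)))
      ≡⟨ cong (λ j → peaks (tent j (bounceFrom w f (2 * s + 2 * j)))) (search-bounce s s<n) ⟩
    peaks (tent (g s ∸ s) (bounceFrom w f (2 * s + 2 * (g s ∸ s))))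
      ≡⟨ peaks-tent _ (m<n⇒0<n∸m s<gs) ⟩
    suc (peaks (bounceFrom w f (2 * s + 2 * (g s ∸ s))))
      ≡⟨ cong (λ x → suc (peaks (bounceFrom w f x))) back-on-axis ⟩
    suc (peaks (bounceFrom w f (2 * g s)))
      ∎
    where
    open ≡-Reasoning
    s<gs = g-expanding s s<n
    back-on-axis : 2 * s + 2 * (g s ∸ s) ≡ 2 * g s
    back-on-axis = trans (sym (*-distribˡ-+ 2 s _)) (cong (2 *_) (m+[n∸m]≡n (<⇒≤ s<gs)))

  bounceFrom-bounces : ∀ f s → n ≤ f + s → Bounces n g s (peaks (bounceFrom w f (2 * s)))
  bounceFrom-bounces zero    s n≤s  = stop n≤s
  bounceFrom-bounces (suc f) s fuel with n ≤? s
  ... | yes n≤s = subst (Bounces n g s ∘ peaks) (sym (bounceFrom-end w f (2 * s) len≤2s)) (stop n≤s)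
    where
    len≤2s : length w ≤ 2 * s
    len≤2s = subst₂ _≤_ (sym length≡n+n) (sym (double s)) (+-mono-≤ n≤s n≤s)
  ... | no n≰s = subst (Bounces n g s) (sym (bounceFrom-hop f s s<n)) (hop s<n (bounceFrom-bounces f (g s) fuel′))
    where
    s<n = ≰⇒> n≰s
    fuel′ : n ≤ f + g s
    fuel′ = ≤-trans fuel (subst (_≤ f + g s) (+-suc f s) (+-monoʳ-≤ f (g-expanding s s<n)))

  bpk-bounces : Bounces n g 0 (peaks (bounce w))
  bpk-bounces = bounceFrom-bounces (length w) 0
                  (subst (n ≤_) (sym (trans (+-identityʳ (length w)) length≡n+n)) (m≤n+m n n))

-- Reading a path step by step

module Scan (w : List Step) (n : ℕ) where
  g : ℕ → ℕ
  g = upsBefore w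

  D : ℕ → ℕ
  D = downsBefore w

  -- w = prefix ++ rest, where the prefix has u up-steps and dn down-steps and ends at height h.
  record Reading (u dn h : ℕ) (rest : List Step) : Set where
    field
      height≡     : u ≡ dn + h
      rest-walk   : walk h rest ≡ just 0
      ups-total   : u + ups rest ≡ n
      downs-total : dn + downs rest ≡ n
      g-agrees    : ∀ k → g (dn + k) ≡ u + upsBefore rest k
      D-agrees    : ∀ k → D (u + k) ≡ dn + downsBefore rest k
  open Reading

  start : IsDyck w → downs w ≡ n → Reading 0 0 0 w
  start isDyck refl = record
    { height≡ = refl ; rest-walk = isDyck ; ups-total = walk-balance 0 w isDyck ; downs-total = refl
    ; g-agrees = λ _ → refl ; D-agrees = λ _ → refl }

  read-up : ∀ {u dn h r} → Reading u dn h (true ∷ r) → Reading (suc u) dn (suc h) r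
  read-up {u} {dn} {h} {r} R = record
    { height≡     = trans (cong suc (height≡ R)) (sym (+-suc dn h))
    ; rest-walk   = rest-walk R
    ; ups-total   = trans (sym (+-suc u (ups r))) (ups-total R)
    ; downs-total = downs-total R
    ; g-agrees    = λ k → trans (g-agrees R k) (+-suc u _)
    ; D-agrees    = λ k → trans (cong D (sym (+-suc u k))) (D-agrees R (suc k)) }

  read-down : ∀ {u dn h r} → Reading u dn (suc h) (false ∷ r) → Reading u (suc dn) h r
  read-down {u} {dn} {h} {r} R = record
    { height≡     = trans (height≡ R) (+-suc dn h)
    ; rest-walk   = rest-walk R
    ; ups-total   = ups-total R
    ; downs-total = trans (sym (+-suc dn (downs r))) (downs-total R)
    ; g-agrees    = λ k → trans (cong g (sym (+-suc dn k))) (g-agrees R (suc k))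
    ; D-agrees    = λ k → trans (D-agrees R k) (+-suc dn _) }

  no-down-at-0 : ∀ {u dn r} → ¬ Reading u dn 0 (false ∷ r)
  no-down-at-0 R with () ← rest-walk R

  at-end : ∀ {u dn h} → Reading u dn h [] → u ≡ n × dn ≡ n × h ≡ 0
  at-end {u} {dn} R with refl ← rest-walk R =
    trans (sym (+-identityʳ u)) (ups-total R) , trans (sym (+-identityʳ dn)) (downs-total R) , refl

  g-at-down : ∀ {u dn h r} → Reading u dn h (false ∷ r) → g dn ≡ u
  g-at-down {u} {dn} R = trans (cong g (sym (+-identityʳ dn))) (trans (g-agrees R 0) (+-identityʳ u))

  D-at-up : ∀ {u dn h r} → Reading u dn h (true ∷ r) → D u ≡ dn
  D-at-up {u} {dn} R = trans (cong D (sym (+-identityʳ u))) (trans (D-agrees R 0) (+-identityʳ dn))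

  u≤n : ∀ {u dn h r} → Reading u dn h r → u ≤ n
  u≤n {u} {r = r} R = subst (u ≤_) (ups-total R) (m≤m+n u (ups r))

  dn≤u : ∀ {u dn h r} → Reading u dn h r → dn ≤ u
  dn≤u {dn = dn} {h} R = subst (dn ≤_) (sym (height≡ R)) (m≤m+n dn h)

  dn<u : ∀ {u dn h r} → Reading u dn (suc h) r → dn < u
  dn<u {dn = dn} {h} R = subst (dn <_) (sym (height≡ R)) (subst (dn <_) (sym (+-suc dn h)) (s≤s (m≤m+n dn h)))

  u<n : ∀ {u dn h r} → Reading u dn h (true ∷ r) → u < n
  u<n {u} {r = r} R = subst (u <_) (ups-total R) (subst (u <_) (sym (+-suc u (ups r))) (s≤s (m≤m+n u (ups r))))

  dn<n : ∀ {u dn h r} → Reading u dn h (false ∷ r) → dn < n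
  dn<n {dn = dn} {r = r} R = subst (dn <_) (downs-total R) (subst (dn <_) (sym (+-suc dn (downs r))) (s≤s (m≤m+n dn (downs r))))

  not-at-end : ∀ {u dn h t} → Reading u dn h [] → dn ≤ t → t < u → ⊥
  not-at-end R dn≤t t<u with refl , refl , _ ← at-end R = <-irrefl refl (≤-<-trans dn≤t t<u)

  bounce-continues : ∀ {u dn h r k} → Reading u dn h (false ∷ r) → Bounces n g (g dn) k → Bounces n g u k
  bounce-continues R = subst (λ s → Bounces n g s _) (g-at-down R)

  bounce-pending : ∀ {u dn h r t} → Reading u dn h r → t < u → ¬ n ≤ t
  bounce-pending R t<u = <⇒≱ (≤-trans t<u (u≤n R))

  no-bounces-at-end : ∀ {u dn h k} → Reading u dn h [] → Bounces n g u k → k ≡ 0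
  no-bounces-at-end R (stop _) = refl
  no-bounces-at-end R (hop u<n _) with refl , _ ← at-end R = contradiction u<n (<-irrefl refl)

-- Upper bound for des + bpk, and the decreasing permutation

desc : ℕ → ℕ → ℕ
desc a b = if b <ᵇ a then 1 else 0

desc-yes : ∀ {a b} → b < a → desc a b ≡ 1
desc-yes {a} {b} = if-yes (b <? a)

desc-no : ∀ {a b} → a ≤ b → desc a b ≡ 0
desc-no {a} {b} a≤b = if-no (b <? a) (≤⇒≯ a≤b)

desc≤1 : ∀ a b → desc a b ≤ 1
desc≤1 a b with b <ᵇ a
... | true  = ≤-refl
... | false = z≤n

descents-cons-≤ : ∀ a b l {k m} → descents (b ∷ l) + k ≤ m → descents (a ∷ b ∷ l) + k ≤ suc m
descents-cons-≤ a b l {k} {m} le = subst (_≤ suc m) (sym (+-assoc (desc a b) _ k)) (+-mono-≤ (desc≤1 a b) le)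

descents-cons-ascent : ∀ {a b} l {k m} → a ≤ b → descents (b ∷ l) + k ≤ m → descents (a ∷ b ∷ l) + k ≤ m
descents-cons-ascent l a≤b le rewrite desc-no a≤b = le

descents-swap-head : ∀ a a′ l → descents (a ∷ l) ≤ suc (descents (a′ ∷ l))
descents-swap-head a a′ []      = z≤n
descents-swap-head a a′ (b ∷ l) = +-mono-≤ (desc≤1 a b) (m≤n+m _ (desc a′ b))

descents-cons-descent : ∀ a b l k {m} → desc a b ≡ 1 → m ≤ descents (b ∷ l) + k →
                        suc m ≤ descents (a ∷ b ∷ l) + k
descents-cons-descent a b l k is-descent le rewrite +-assoc (desc a b) (descents (b ∷ l)) k | is-descent = s≤s le

descents-cons-≥ : ∀ a b l k {m} → m ≤ descents (b ∷ l) + k → m ≤ descents (a ∷ b ∷ l) + k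
descents-cons-≥ a b l k le =
  ≤-trans le (subst (descents (b ∷ l) + k ≤_) (sym (+-assoc (desc a b) _ k)) (m≤n+m _ (desc a b)))

≤-+-suc : ∀ {m} x y → m ≤ x + y → suc m ≤ x + suc y
≤-+-suc {m} x y le = subst (suc m ≤_) (sym (+-suc x y)) (s≤s le)

module UpperBound (w : List Step) (n : ℕ) (L : ℕ → ℕ) where
  open Scan w n

  descend-or-ascend : ∀ {t k m} prev x l → prev ≤ L t → (∀ y → y ≤ L t → descents (y ∷ l) + k ≤ m) →
                      descents (prev ∷ x ∷ l) + k ≤ suc m
  descend-or-ascend {t} {k} prev x l prev≤ bound with x <? prev
  ... | yes x<prev = descents-cons-≤ prev x l (bound x (≤-trans (<⇒≤ x<prev) prev≤))
  ... | no  x≮prev = descents-cons-ascent l (≮⇒≥ x≮prev)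
                       (≤-trans (+-monoˡ-≤ k (descents-swap-head x (L t) l)) (s≤s (bound (L t) ≤-refl)))

  mutual
    awaiting-up : ∀ {u dn h k} rest prev → Reading u dn h rest → Bounces n g u k →
                  descents (prev ∷ canAux L u dn rest) + k ≤ length rest
    awaiting-up [] prev R b = ≤-reflexive (no-bounces-at-end R b)
    awaiting-up {u} {dn} (true ∷ r) prev R b =
      descents-cons-≤ prev (L u) (canAux L (suc u) dn r) (awaiting-down r (L u) (read-up R) (dn≤u R) (n<1+n u) ≤-refl b)
    awaiting-up {h = zero}  (false ∷ r) prev R b = ⊥-elim (no-down-at-0 R)
    awaiting-up {u} {dn} {suc h} (false ∷ r) prev R b =
      descents-cons-≤ prev (L dn) (canAux L u (suc dn) r) (awaiting-up r (L dn) (read-down R) b)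

    -- Inside the bounce block of t: prev ≤ L t as long as the labels since up-step t descend.
    awaiting-down : ∀ {u dn h t k} rest prev → Reading u dn h rest → dn ≤ t → t < u → prev ≤ L t →
                    Bounces n g t k → descents (prev ∷ canAux L u dn rest) + k ≤ length rest
    awaiting-down [] prev R dn≤t t<u _ _ = ⊥-elim (not-at-end R dn≤t t<u)
    awaiting-down {u} {dn} (true ∷ r) prev R dn≤t t<u prev≤ b =
      descend-or-ascend prev (L u) (canAux L (suc u) dn r) prev≤
        (λ y y≤ → awaiting-down r y (read-up R) dn≤t (≤-trans t<u (n≤1+n u)) y≤ b)
    awaiting-down {h = zero} (false ∷ r) prev R _ _ _ _ = ⊥-elim (no-down-at-0 R)
    awaiting-down {u} {dn} {suc h} (false ∷ r) prev R dn≤t t<u prev≤ b with dn ≟ _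
    ... | no dn≢t  = descend-or-ascend prev (L dn) (canAux L u (suc dn) r) prev≤
                       (λ y y≤ → awaiting-down r y (read-down R) (≤∧≢⇒< dn≤t dn≢t) t<u y≤ b)
    awaiting-down {u} {dn} {suc h} (false ∷ r) prev R dn≤t t<u prev≤ (stop n≤dn) | yes refl =
      contradiction n≤dn (bounce-pending R t<u)
    awaiting-down {u} {dn} {suc h} (false ∷ r) prev R dn≤t t<u prev≤ (hop _ b) | yes refl =
      descents-cons-ascent (canAux L u (suc dn) r) prev≤ (subst (_≤ suc (length r)) (sym (+-suc _ _))
        (s≤s (awaiting-up r (L dn) (read-down R) (bounce-continues R b))))

  des+bounces≤ : ∀ {k} rest → Reading 0 0 0 rest → Bounces n g 0 k →
                 descents (canAux L 0 0 rest) + k ≤ length rest ∸ 1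
  des+bounces≤ []          R b = ≤-reflexive (no-bounces-at-end R b)
  des+bounces≤ (true ∷ r)  R b = awaiting-down r (L 0) (read-up R) z≤n (s≤s z≤n) ≤-refl b
  des+bounces≤ (false ∷ r) R b = ⊥-elim (no-down-at-0 R)

module DecreasingLabels (w : List Step) (n : ℕ) where
  open Scan w n

  Lδ : ℕ → ℕ
  Lδ i = n ∸ suc i

  Lδ-< : ∀ {a b} → a < b → b < n → Lδ b < Lδ a
  Lδ-< a<b b<n = ∸-monoʳ-< (s≤s a<b) b<n

  Lδ-≤ : ∀ {a b} → a ≤ b → Lδ b ≤ Lδ a
  Lδ-≤ a≤b = ∸-monoʳ-≤ n (s≤s a≤b)

  mutual
    after-up : ∀ {i dn h} rest → Reading (suc i) dn h rest →
               descents (Lδ i ∷ canAux Lδ (suc i) dn rest) + peaks (true ∷ rest) ≡ length rest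
    after-up [] R = refl
    after-up {i} (true ∷ r) R rewrite desc-yes (Lδ-< (n<1+n i) (u<n R)) = cong suc (after-up r (read-up R))
    after-up {h = zero} (false ∷ r) R = ⊥-elim (no-down-at-0 R)
    after-up {h = suc h} (false ∷ r) R rewrite desc-no (Lδ-≤ (≤-pred (dn<u R))) =
      trans (+-suc _ _) (cong suc (after-down r (read-down R)))

    after-down : ∀ {i u h} rest → Reading u (suc i) h rest →
                 descents (Lδ i ∷ canAux Lδ u (suc i) rest) + peaks (false ∷ rest) ≡ length rest
    after-down [] R = refl
    after-down (true ∷ r) R rewrite desc-yes (Lδ-< (dn≤u R) (u<n R)) = cong suc (after-up r (read-up R))
    after-down {h = zero} (false ∷ r) R = ⊥-elim (no-down-at-0 R)
    after-down {i} {h = suc h} (false ∷ r) R rewrite desc-yes (Lδ-< (n<1+n i) (dn<n R)) =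
      cong suc (after-down r (read-down R))

  des+peaks≡ : ∀ rest → Reading 0 0 0 rest → descents (canAux Lδ 0 0 rest) + peaks rest ≡ length rest ∸ 1
  des+peaks≡ []          R = refl
  des+peaks≡ (true ∷ r)  R = after-up r (read-up R)
  des+peaks≡ (false ∷ r) R = ⊥-elim (no-down-at-0 R)

canAux-cong : ∀ {f f′ : ℕ → ℕ} → (∀ i → f i ≡ f′ i) → ∀ u dn w → canAux f u dn w ≡ canAux f′ u dn w
canAux-cong f≗f′ u dn []          = refl
canAux-cong f≗f′ u dn (true ∷ w)  = cong₂ _∷_ (f≗f′ u) (canAux-cong f≗f′ (suc u) dn w)
canAux-cong f≗f′ u dn (false ∷ w) = cong₂ _∷_ (f≗f′ dn) (canAux-cong f≗f′ u (suc dn) w)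

label-δ : ∀ n i → label (δ n) i ≡ n ∸ suc i
label-δ n i with i <? n
... | yes p  = trans (Fin.opposite-prop (fromℕ< p)) (cong (λ x → n ∸ suc x) (Fin.toℕ-fromℕ< p))
... | no i≮n = sym (m≤n⇒m∸n≡0 (≤-trans (≮⇒≥ i≮n) (n≤1+n i)))

-- An automaton recognising pk = bpk

-- falling h r: at height h, r more down-steps to read up to and including the current bounce
-- point's down-step (r = 0: it has been read, and the next up-step starts a new bounce block);
-- rising v h: at height h, the bounce point's down-step is the (v + 1)-th down-step still to come.
data State : Set where
  rising falling : ℕ → ℕ → State
  dead           : State

step : State → Step → State
step (rising v h)              true  = rising v (suc h)
step (rising v zero)           false = dead
step (rising v (suc h))        false = falling h v
step (falling h zero)          true  = rising h (suc h)
step (falling h (suc r))       true  = dead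
step (falling zero r)          false = dead
step (falling (suc h) zero)    false = falling h zero
step (falling (suc h) (suc r)) false = falling h r
step dead                      _     = dead

final : State → Bool
final (falling zero zero) = true
final _                   = false

accepts : State → List Step → Bool
accepts s []      = final s
accepts s (x ∷ w) = accepts (step s x) w

level : State → ℕ
level (rising v h)  = h
level (falling h r) = h
level dead          = 0

dead-rejects : ∀ w → accepts dead w ≡ false
dead-rejects []      = refl
dead-rejects (_ ∷ w) = dead-rejects w

accepts⇒walk : ∀ s w → accepts s w ≡ true → walk (level s) w ≡ just 0
accepts⇒walk (falling zero zero)      []          _ = refl
accepts⇒walk (rising v h)              (true ∷ w)  a = accepts⇒walk (rising v (suc h)) w a
accepts⇒walk (rising v (suc h))        (false ∷ w) a = accepts⇒walk (falling h v) w a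
accepts⇒walk (falling h zero)          (true ∷ w)  a = accepts⇒walk (rising h (suc h)) w a
accepts⇒walk (falling (suc h) zero)    (false ∷ w) a = accepts⇒walk (falling h zero) w a
accepts⇒walk (falling (suc h) (suc r)) (false ∷ w) a = accepts⇒walk (falling h r) w a
accepts⇒walk (rising v zero)           (false ∷ w) a with () ← trans (sym a) (dead-rejects w)
accepts⇒walk (falling h (suc r))       (true ∷ w)  a with () ← trans (sym a) (dead-rejects w)
accepts⇒walk (falling zero zero)       (false ∷ w) a with () ← trans (sym a) (dead-rejects w)
accepts⇒walk (falling zero (suc r))    (false ∷ w) a with () ← trans (sym a) (dead-rejects w)
accepts⇒walk dead                      w           a with () ← trans (sym a) (dead-rejects w)

rejected-nonempty : ∀ w → accepts (falling 0 0) w ≡ false → length w ∸ 1 < length w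
rejected-nonempty (_ ∷ w) _ = n<1+n (length w)

Verdict : Bool → ℕ → ℕ → Set
Verdict b p k = (b ≡ true → p ≡ k) × (b ≡ false → k < p)

Verdict-suc : ∀ {b p k} → Verdict b p k → Verdict b (suc p) (suc k)
Verdict-suc (accept , reject) = cong suc ∘ accept , s≤s ∘ reject

module PeaksVsBounces (w : List Step) (n : ℕ) where
  open Scan w n

  mutual
    bounces≤peaks : ∀ {u dn h k} rest → Reading u dn h rest → Bounces n g u k → k ≤ peaks rest
    bounces≤peaks [] R b = ≤-reflexive (no-bounces-at-end R b)
    bounces≤peaks {u} (true ∷ r) R b = bounces≤peaks-rising r (read-up R) (dn≤u R) (n<1+n u) b
    bounces≤peaks {h = zero}  (false ∷ r) R b = ⊥-elim (no-down-at-0 R)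
    bounces≤peaks {h = suc h} (false ∷ r) R b = bounces≤peaks r (read-down R) b

    bounces≤peaks-rising : ∀ {u dn h t k} rest → Reading u dn h rest → dn ≤ t → t < u →
                           Bounces n g t k → k ≤ peaks (true ∷ rest)
    bounces≤peaks-rising [] R dn≤t t<u b = ⊥-elim (not-at-end R dn≤t t<u)
    bounces≤peaks-rising {u} (true ∷ r) R dn≤t t<u b =
      bounces≤peaks-rising r (read-up R) dn≤t (≤-trans t<u (n≤1+n u)) b
    bounces≤peaks-rising (false ∷ r) R dn≤t t<u b = bounces≤peaks-peaked (false ∷ r) R dn≤t t<u b

    bounces≤peaks-peaked : ∀ {u dn h t k} rest → Reading u dn h rest → dn ≤ t → t < u →
                           Bounces n g t k → k ≤ suc (peaks rest)
    bounces≤peaks-peaked [] R dn≤t t<u b = ⊥-elim (not-at-end R dn≤t t<u)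
    bounces≤peaks-peaked {u} (true ∷ r) R dn≤t t<u b =
      ≤-trans (bounces≤peaks-rising r (read-up R) dn≤t (≤-trans t<u (n≤1+n u)) b) (n≤1+n _)
    bounces≤peaks-peaked {h = zero} (false ∷ r) R _ _ _ = ⊥-elim (no-down-at-0 R)
    bounces≤peaks-peaked {u} {dn} {suc h} (false ∷ r) R dn≤t t<u b with dn ≟ _
    ... | no dn≢t = bounces≤peaks-peaked r (read-down R) (≤∧≢⇒< dn≤t dn≢t) t<u b
    bounces≤peaks-peaked {u} {dn} {suc h} (false ∷ r) R dn≤t t<u (stop n≤dn) | yes refl =
      contradiction n≤dn (bounce-pending R t<u)
    bounces≤peaks-peaked {u} {dn} {suc h} (false ∷ r) R dn≤t t<u (hop _ b) | yes refl =
      s≤s (bounces≤peaks r (read-down R) (bounce-continues R b))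

  mutual
    verdict-falling : ∀ {u dn h k} rest → Reading u dn h rest → Bounces n g u k →
                      Verdict (accepts (falling h 0) rest) (peaks rest) k
    verdict-falling [] R b with refl , _ , refl ← at-end R = (λ _ → sym (no-bounces-at-end R b)) , λ ()
    verdict-falling {u} {dn} {h} (true ∷ r) R b =
      verdict-rising r (read-up R) (trans (+-comm h dn) (sym (Reading.height≡ R))) (n<1+n u) b
    verdict-falling {h = zero}  (false ∷ r) R b = ⊥-elim (no-down-at-0 R)
    verdict-falling {h = suc h} (false ∷ r) R b = verdict-falling r (read-down R) b

    verdict-rising : ∀ {u dn h v t k} rest → Reading u dn h rest → v + dn ≡ t → t < u →
                     Bounces n g t k → Verdict (accepts (rising v h) rest) (peaks (true ∷ rest)) k
    verdict-rising {dn = dn} {v = v} [] R refl t<u b = ⊥-elim (not-at-end R (m≤n+m dn v) t<u)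
    verdict-rising {u} (true ∷ r) R v+dn≡t t<u b = verdict-rising r (read-up R) v+dn≡t (≤-trans t<u (n≤1+n u)) b
    verdict-rising {h = zero} (false ∷ r) R _ _ _ = ⊥-elim (no-down-at-0 R)
    verdict-rising {h = suc h} {zero} (false ∷ r) R refl t<u (stop n≤t) =
      contradiction n≤t (bounce-pending R t<u)
    verdict-rising {h = suc h} {zero} (false ∷ r) R refl t<u (hop _ b) =
      Verdict-suc (verdict-falling r (read-down R) (bounce-continues R b))
    verdict-rising {dn = dn} {suc h} {suc v} (false ∷ r) R v+dn≡t t<u b =
      verdict-peaked r (read-down R) (trans (+-suc v dn) v+dn≡t) t<u b

    verdict-peaked : ∀ {u dn h r t k} rest → Reading u dn h rest → r + dn ≡ t → t < u →
                     Bounces n g t k → Verdict (accepts (falling h (suc r)) rest) (suc (peaks rest)) k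
    verdict-peaked {dn = dn} {r = r} [] R refl t<u b = ⊥-elim (not-at-end R (m≤n+m dn r) t<u)
    verdict-peaked {u} {dn} {r = r} (true ∷ rest) R refl t<u b =
      (λ a → contradiction (trans (sym a) (dead-rejects rest)) λ ()) ,
      (λ _ → s≤s (bounces≤peaks-rising rest (read-up R) (m≤n+m dn r) (≤-trans t<u (n≤1+n u)) b))
    verdict-peaked {h = zero} (false ∷ rest) R _ _ _ = ⊥-elim (no-down-at-0 R)
    verdict-peaked {h = suc h} {zero} (false ∷ rest) R refl t<u (stop n≤t) =
      contradiction n≤t (bounce-pending R t<u)
    verdict-peaked {h = suc h} {zero} (false ∷ rest) R refl t<u (hop _ b) =
      Verdict-suc (verdict-falling rest (read-down R) (bounce-continues R b))
    verdict-peaked {dn = dn} {suc h} {suc r} (false ∷ rest) R r+dn≡t t<u b =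
      verdict-peaked rest (read-down R) (trans (+-suc r dn) r+dn≡t) t<u b

bounce-verdict : ∀ w → IsDyck w → Verdict (accepts (falling 0 0) w) (peaks w) (peaks (bounce w))
bounce-verdict w isDyck =
  PeaksVsBounces.verdict-falling w (downs w) w (Scan.start w (downs w) isDyck refl) (BouncePath.bpk-bounces w isDyck)

-- Beating the decreasing permutation when pk ≠ bpk

#below : (n : ℕ) {P : ℕ → Set} → (∀ j → Dec (P j)) → ℕ
#below zero    P? = 0
#below (suc n) P? = #below n P? + (if does (P? n) then 1 else 0)

#below-all : ∀ n → #below n (λ _ → yes tt) ≡ n
#below-all zero    = refl
#below-all (suc n) = trans (cong (_+ 1) (#below-all n)) (+-comm n 1)

module _ {P Q : ℕ → Set} (P? : ∀ j → Dec (P j)) (Q? : ∀ j → Dec (Q j)) where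
  indicator-mono : ∀ j → (P j → Q j) → (if does (P? j) then 1 else 0) ≤ (if does (Q? j) then 1 else 0)
  indicator-mono j P⇒Q with P? j | Q? j
  ... | yes _  | yes _  = ≤-refl
  ... | yes Pj | no ¬Qj = contradiction (P⇒Q Pj) ¬Qj
  ... | no _   | _      = z≤n

  #below-mono : ∀ n → (∀ {j} → j < n → P j → Q j) → #below n P? ≤ #below n Q?
  #below-mono zero    _   = z≤n
  #below-mono (suc n) P⇒Q = +-mono-≤ (#below-mono n (P⇒Q ∘ m<n⇒m<1+n)) (indicator-mono n (P⇒Q ≤-refl))

  #below-strict : ∀ n → (∀ {j} → j < n → P j → Q j) → ∀ {j} → j < n → ¬ P j → Q j →
                  #below n P? < #below n Q?
  #below-strict (suc n) P⇒Q {j} j<1+n ¬Pj Qj with j ≟ n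
  ... | yes refl rewrite dec-false (P? j) ¬Pj | dec-true (Q? j) Qj =
    +-mono-≤-< (#below-mono n (P⇒Q ∘ m<n⇒m<1+n)) (s≤s z≤n)
  ... | no j≢n =
    +-mono-<-≤ (#below-strict n (P⇒Q ∘ m<n⇒m<1+n) (≤∧≢⇒< (≤-pred j<1+n) j≢n) ¬Pj Qj)
               (indicator-mono n (P⇒Q ≤-refl))

injective⇒surjective : ∀ {m} (f : Fin m → Fin m) → (∀ {x y} → f x ≡ f y → x ≡ y) →
                       ∀ y → ∃ λ x → f x ≡ y
injective⇒surjective {suc m} f f-injective y with Fin.any? (λ x → f x Fin.≟ y)
... | yes hit = hit
... | no  miss = contradiction (Fin.injective⇒≤ squeeze-injective) 1+n≰n
  where
  f≢y : ∀ x → y ≢ f x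
  f≢y x y≡fx = miss (x , sym y≡fx)
  squeeze : Fin (suc m) → Fin m
  squeeze x = punchOut (f≢y x)
  squeeze-injective : ∀ {x x′} → squeeze x ≡ squeeze x′ → x ≡ x′
  squeeze-injective = f-injective ∘ Fin.punchOut-injective (f≢y _) (f≢y _)

-- Opaque, so that goals mentioning the permutation are not normalised into its inverse and proofs.
opaque
  permutationOf : ∀ {m} (f : Fin m → Fin m) → (∀ {x y} → f x ≡ f y → x ≡ y) → Permutation′ m
  permutationOf f f-injective = permutation f (proj₁ ∘ onto) (proj₂ ∘ onto) (λ x → f-injective (proj₂ (onto (f x))))
    where
    onto : ∀ y → ∃ λ x → f x ≡ y
    onto = injective⇒surjective f f-injective

  permutationOf-apply : ∀ {m} (f : Fin m → Fin m) (f-injective : ∀ {x y} → f x ≡ f y → x ≡ y) x →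
                        permutationOf f f-injective ⟨$⟩ʳ x ≡ f x
  permutationOf-apply f f-injective x = refl

open StrictTotalOrder (×-strictTotalOrder <-strictTotalOrder <-strictTotalOrder)
  using ()
  renaming (_<_ to _<ₗₑₓ_; _<?_ to _<ₗₑₓ?_; irrefl to <ₗₑₓ-irrefl; trans to <ₗₑₓ-trans; compare to <ₗₑₓ-compare)

module Ranking (n : ℕ) (key : ℕ → ℕ × ℕ)
               (key-injective : ∀ {a b} → a < n → b < n → key a ≡ key b → a ≡ b) where

  _≺_ : ℕ → ℕ → Set
  a ≺ b = key a <ₗₑₓ key b

  rank : ℕ → ℕ
  rank a = #below n (λ j → key j <ₗₑₓ? key a)

  rank<n : ∀ {a} → a < n → rank a < n
  rank<n {a} a<n = subst (rank a <_) (#below-all n)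
    (#below-strict (λ j → key j <ₗₑₓ? key a) (λ _ → yes tt) n (λ _ _ → tt) a<n (<ₗₑₓ-irrefl (refl , refl)) tt)

  rank-mono : ∀ {a b} → a < n → a ≺ b → rank a < rank b
  rank-mono {a} {b} a<n a≺b =
    #below-strict (λ j → key j <ₗₑₓ? key a) (λ j → key j <ₗₑₓ? key b) n (λ _ j≺a → <ₗₑₓ-trans j≺a a≺b)
                  a<n (<ₗₑₓ-irrefl (refl , refl)) a≺b

  rank-injective : ∀ {a b} → a < n → b < n → rank a ≡ rank b → a ≡ b
  rank-injective {a} {b} a<n b<n same-rank with <ₗₑₓ-compare (key a) (key b)
  ... | tri< a≺b _ _ = contradiction same-rank (<⇒≢ (rank-mono a<n a≺b))
  ... | tri≈ _ same _ = key-injective a<n b<n (≡×≡⇒≡ same)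
  ... | tri> _ _ b≺a = contradiction (sym same-rank) (<⇒≢ (rank-mono b<n b≺a))

  position : Fin n → Fin n
  position x = opposite (fromℕ< (rank<n (Fin.toℕ<n x)))

  position-injective : ∀ {x y} → position x ≡ position y → x ≡ y
  position-injective {x} {y} eq = Fin.toℕ-injective (rank-injective (Fin.toℕ<n x) (Fin.toℕ<n y) (begin
    rank (toℕ x)                            ≡⟨ sym (Fin.toℕ-fromℕ< _) ⟩
    toℕ (fromℕ< (rank<n (Fin.toℕ<n x)))     ≡⟨ cong toℕ (opposite-injective eq) ⟩
    toℕ (fromℕ< (rank<n (Fin.toℕ<n y)))     ≡⟨ Fin.toℕ-fromℕ< _ ⟩
    rank (toℕ y)                            ∎))
    where
    open ≡-Reasoning
    opposite-injective : ∀ {i j : Fin n} → opposite i ≡ opposite j → i ≡ j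
    opposite-injective {i} {j} e = trans (sym (Fin.opposite-involutive i)) (trans (cong opposite e) (Fin.opposite-involutive j))

  σ : Permutation′ n
  σ = permutationOf position position-injective

  toℕ-position : ∀ x → toℕ (position x) ≡ n ∸ suc (rank (toℕ x))
  toℕ-position x = trans (Fin.opposite-prop (fromℕ< (rank<n (Fin.toℕ<n x))))
                         (cong (λ r → n ∸ suc r) (Fin.toℕ-fromℕ< (rank<n (Fin.toℕ<n x))))

  label-σ : ∀ {a} → a < n → label σ a ≡ n ∸ suc (rank a)
  label-σ {a} a<n with a <? n
  ... | yes p  = begin
    toℕ (σ ⟨$⟩ʳ fromℕ< p)         ≡⟨ cong toℕ (permutationOf-apply position position-injective (fromℕ< p)) ⟩
    toℕ (position (fromℕ< p))     ≡⟨ toℕ-position (fromℕ< p) ⟩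
    n ∸ suc (rank (toℕ (fromℕ< p))) ≡⟨ cong (λ i → n ∸ suc (rank i)) (Fin.toℕ-fromℕ< p) ⟩
    n ∸ suc (rank a)               ∎
    where open ≡-Reasoning
  ... | no a≮n = contradiction a<n a≮n

  descent : ∀ {a b} → a < n → b < n → a ≺ b → desc (label σ a) (label σ b) ≡ 1
  descent a<n b<n a≺b rewrite label-σ a<n | label-σ b<n = desc-yes (∸-monoʳ-< (s≤s (rank-mono a<n a≺b)) (rank<n b<n))

-- Indices below E keep their natural order, as do indices from E on (D being monotone); an index
-- a < E comes before an index b ≥ E exactly when a < D b, as n + a exceeds every index.
module MergeOrder (n E : ℕ) (D : ℕ → ℕ) (D-mono : ∀ {i j} → i ≤ j → D i ≤ D j) where
  key : ℕ → ℕ × ℕ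
  key a with a <? E
  ... | yes _ = a , n + a
  ... | no  _ = D a , a

  side : ∀ a → a < E ⊎ E ≤ a
  side a with a <? E
  ... | yes a<E = inj₁ a<E
  ... | no  a≮E = inj₂ (≮⇒≥ a≮E)

  key-low : ∀ {a} → a < E → key a ≡ (a , n + a)
  key-low {a} a<E with a <? E
  ... | yes _  = refl
  ... | no a≮E = contradiction a<E a≮E

  key-high : ∀ {a} → E ≤ a → key a ≡ (D a , a)
  key-high {a} E≤a with a <? E
  ... | yes a<E = contradiction E≤a (<⇒≱ a<E)
  ... | no  _   = refl

  key-injective : ∀ {a b} → a < n → b < n → key a ≡ key b → a ≡ b
  key-injective {a} {b} a<n b<n same with a <? E | b <? E
  ... | yes _ | yes _ = cong proj₁ same
  ... | no  _ | no  _ = cong proj₂ same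
  ... | yes _ | no  _ = contradiction (subst (n ≤_) (cong proj₂ same) (m≤m+n n a)) (<⇒≱ b<n)
  ... | no  _ | yes _ = contradiction (subst (n ≤_) (sym (cong proj₂ same)) (m≤m+n n b)) (<⇒≱ a<n)

  open Ranking n key key-injective public

  low≺high : ∀ {a b} → a < E → E ≤ b → a < D b → a ≺ b
  low≺high a<E E≤b a<Db = subst₂ _<ₗₑₓ_ (sym (key-low a<E)) (sym (key-high E≤b)) (inj₁ a<Db)

  high≺low : ∀ {a b} → E ≤ a → b < E → D a ≡ b → a < n → a ≺ b
  high≺low {a} {b} E≤a b<E Da≡b a<n =
    subst₂ _<ₗₑₓ_ (sym (key-high E≤a)) (sym (key-low b<E)) (inj₂ (Da≡b , ≤-trans a<n (m≤m+n n b)))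

  ≺-step : ∀ {a b} → a < b → (a < E → b < E) → a ≺ b
  ≺-step {a} {b} a<b stays-low with side a
  ... | inj₁ a<E = subst₂ _<ₗₑₓ_ (sym (key-low a<E)) (sym (key-low (stays-low a<E))) (inj₁ a<b)
  ... | inj₂ E≤a = subst₂ _<ₗₑₓ_ (sym (key-high E≤a)) (sym (key-high (≤-trans E≤a (<⇒≤ a<b)))) high-order
    where
    high-order : (D a , a) <ₗₑₓ (D b , b)
    high-order with m≤n⇒m<n∨m≡n (D-mono (<⇒≤ a<b))
    ... | inj₁ Da<Db = inj₁ Da<Db
    ... | inj₂ Da≡Db = inj₂ (Da≡Db , a<b)

  ≺-low-step : ∀ {a b} → a < b → b < E → a ≺ b
  ≺-low-step a<b b<E = ≺-step a<b (λ _ → b<E)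

  ≺-high-step : ∀ {a b} → E ≤ a → a < b → a ≺ b
  ≺-high-step E≤a a<b = ≺-step a<b (λ a<E → contradiction E≤a (<⇒≱ a<E))

  ≺-valley : ∀ {a b} → a < b → D b ≡ suc a → a ≺ b
  ≺-valley {a} {b} a<b Db≡ with side a | side b
  ... | inj₁ a<E | inj₂ E≤b = low≺high a<E E≤b (subst (a <_) (sym Db≡) ≤-refl)
  ... | inj₁ a<E | inj₁ b<E = ≺-low-step a<b b<E
  ... | inj₂ E≤a | _        = ≺-high-step E≤a a<b

-- The first up-step of the rise in which the automaton dies, when it reads rest from state s after u
-- up-steps, e being the first up-step of the current rise.
riseStart : State → ℕ → ℕ → List Step → ℕ
riseStart s                   e u []          = e
riseStart s                   e u (false ∷ r) = riseStart (step s false) e u r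
riseStart (rising v h)        e u (true ∷ r)  = riseStart (rising v (suc h)) e (suc u) r
riseStart (falling h zero)    e u (true ∷ r)  = riseStart (rising h (suc h)) u (suc u) r
riseStart (falling h (suc k)) e u (true ∷ r)  = e
riseStart dead                e u (true ∷ r)  = e

riseStart-range : ∀ s e u rest → riseStart s e u rest ≡ e ⊎ u ≤ riseStart s e u rest
riseStart-range s                   e u []          = inj₁ refl
riseStart-range s                   e u (false ∷ r) = riseStart-range (step s false) e u r
riseStart-range (rising v h)        e u (true ∷ r)  with riseStart-range (rising v (suc h)) e (suc u) r
... | inj₁ same = inj₁ same
... | inj₂ later = inj₂ (≤-trans (n≤1+n u) later)
riseStart-range (falling h zero)    e u (true ∷ r)  with riseStart-range (rising h (suc h)) u (suc u) r
... | inj₁ here  = inj₂ (≤-reflexive (sym here))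
... | inj₂ later = inj₂ (≤-trans (n≤1+n u) later)
riseStart-range (falling h (suc k)) e u (true ∷ r)  = inj₁ refl
riseStart-range dead                e u (true ∷ r)  = inj₁ refl

riseStart-settled : ∀ h e u rest → walk h rest ≡ just 0 → accepts (falling h 0) rest ≡ false →
                    u ≤ riseStart (falling h 0) e u rest
riseStart-settled zero    e u []          _ ()
riseStart-settled h       e u (true ∷ r)  _ _ with riseStart-range (rising h (suc h)) u (suc u) r
... | inj₁ here  = ≤-reflexive (sym here)
... | inj₂ later = ≤-trans (n≤1+n u) later
riseStart-settled (suc h) e u (false ∷ r) walks rejected = riseStart-settled h e u r walks rejected

-- E is the first up-step of the bounce block in which the automaton dies.  For the merge order at E
-- every pair of adjacent steps contributes at least 1 to des + pk, as for δ, except possibly the pair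
-- (down-step E − 1, down-step E); lossAhead x is 1 while that pair may still come.  The peak ending
-- the first rise of the block is a descent (its up-step is ≥ E and its down-step < E), and so is the
-- following peak whenever the loss does occur.
module LowerBound (w : List Step) (n : ℕ) where
  open Scan w n
  open Reading

  E : ℕ
  E = riseStart (falling 0 0) 0 0 w

  open MergeOrder n E D (downsBefore-mono w) public

  -- Opaque for the same reason as permutationOf.
  opaque
    L : ℕ → ℕ
    L = label σ

    L≡label : L ≡ label σ
    L≡label = refl

    L-descent : ∀ {a b} → a < n → b < n → a ≺ b → desc (L a) (L b) ≡ 1
    L-descent = descent

  desFrom : ℕ → ℕ → ℕ → List Step → ℕ
  desFrom a u dn rest = descents (L a ∷ canAux L u dn rest)

  lossAhead : ℕ → ℕ
  lossAhead x = if x <ᵇ E then 1 else 0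

  with-loss : ∀ {x} → x < E → ∀ P → P + lossAhead x ≡ suc P
  with-loss {x} x<E P = trans (cong (λ c → P + c) (if-yes (x <? E) x<E)) (+-comm P 1)

  without-loss : ∀ {x} → ¬ x < E → ∀ P → P + lossAhead x ≡ P
  without-loss {x} x≮E P = trans (cong (λ c → P + c) (if-no (x <? E) x≮E)) (+-identityʳ P)

  less-loss : ∀ X P x {m} → m ≤ X + (P + lossAhead (suc x)) → m ≤ X + (P + lossAhead x)
  less-loss X P x {m} le with suc x <? E
  ... | yes x+1<E = subst (λ q → m ≤ X + q) (trans (with-loss x+1<E P) (sym (with-loss (<-trans (n<1+n x) x+1<E) P))) le
  ... | no  x+1≮E = ≤-trans (subst (λ q → m ≤ X + q) (without-loss x+1≮E P) le) (+-monoʳ-≤ X (m≤m+n P _))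

  prev-up<n : ∀ {pu dn h r} → Reading (suc pu) dn h r → pu < n
  prev-up<n = u≤n

  prev-down<n : ∀ {u pd h r} → Reading u (suc pd) h r → pd < n
  prev-down<n R = ≤-trans (dn≤u R) (u≤n R)

  mutual
    past-E-up : ∀ {pu dn h} rest → Reading (suc pu) dn h rest → E ≤ pu →
                length rest ≤ desFrom pu (suc pu) dn rest + (peaks (true ∷ rest) + lossAhead dn)
    past-E-up [] R E≤pu = z≤n
    past-E-up {pu} {dn} (true ∷ r) R E≤pu =
      descents-cons-descent (L pu) (L (suc pu)) (canAux L (suc (suc pu)) dn r) (peaks (true ∷ r) + lossAhead dn)
        (L-descent (prev-up<n R) (u<n R) (≺-high-step E≤pu (n<1+n pu)))
        (past-E-up r (read-up R) (≤-trans E≤pu (n≤1+n pu)))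
    past-E-up {h = zero} (false ∷ r) R E≤pu = ⊥-elim (no-down-at-0 R)
    past-E-up {pu} {dn} {suc h} (false ∷ r) R E≤pu =
      descents-cons-≥ (L pu) (L dn) (canAux L (suc pu) (suc dn) r) (suc (peaks r) + lossAhead dn)
        (≤-+-suc (desFrom dn (suc pu) (suc dn) r) _ (past-E-down r (read-down R) (s≤s E≤pu)))

    past-E-down : ∀ {pd u h} rest → Reading u (suc pd) h rest → E < u →
                  length rest ≤ desFrom pd u (suc pd) rest + (peaks (false ∷ rest) + lossAhead pd)
    past-E-down [] R E<u = z≤n
    past-E-down {pd} {u} (true ∷ r) R E<u =
      descents-cons-descent (L pd) (L u) (canAux L (suc u) (suc pd) r) (peaks (true ∷ r) + lossAhead pd)
        (L-descent (prev-down<n R) (u<n R) (≺-valley (dn≤u R) (D-at-up R)))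
        (less-loss (desFrom u (suc u) (suc pd) r) (peaks (true ∷ r)) pd (past-E-up r (read-up R) (<⇒≤ E<u)))
    past-E-down {h = zero} (false ∷ r) R E<u = ⊥-elim (no-down-at-0 R)
    past-E-down {pd} {u} {suc h} (false ∷ r) R E<u with suc pd ≟ E
    ... | yes pd+1≡E =
      descents-cons-≥ (L pd) (L (suc pd)) (canAux L u (suc (suc pd)) r) (peaks r + lossAhead pd)
        (subst (λ q → suc (length r) ≤ X + q) (sym (with-loss (subst (pd <_) pd+1≡E ≤-refl) (peaks r)))
          (≤-+-suc X (peaks r) (subst (λ q → length r ≤ X + q) (without-loss (<-irrefl pd+1≡E) (peaks r))
            (past-E-down r (read-down R) E<u))))
      where X = desFrom (suc pd) u (suc (suc pd)) r
    ... | no pd+1≢E =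
      descents-cons-descent (L pd) (L (suc pd)) (canAux L u (suc (suc pd)) r) (peaks r + lossAhead pd)
        (L-descent (prev-down<n R) (dn<n R) (≺-step (n<1+n pd) (λ pd<E → ≤∧≢⇒< pd<E pd+1≢E)))
        (less-loss (desFrom (suc pd) u (suc (suc pd)) r) (peaks r) pd (past-E-down r (read-down R) E<u))

  after-rejection : ∀ {pu dn h} rest → Reading (suc pu) dn h rest → E ≤ pu → dn < E → D pu ≡ dn →
                    length rest ≤ desFrom pu (suc pu) dn rest + peaks (true ∷ rest)
  after-rejection [] R E≤pu dn<E Dpu≡dn = z≤n
  after-rejection {pu} {dn} (true ∷ r) R E≤pu dn<E Dpu≡dn =
    descents-cons-descent (L pu) (L (suc pu)) (canAux L (suc (suc pu)) dn r) (peaks (true ∷ r))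
      (L-descent (prev-up<n R) (u<n R) (≺-high-step E≤pu (n<1+n pu)))
      (after-rejection r (read-up R) (≤-trans E≤pu (n≤1+n pu)) dn<E (D-at-up R))
  after-rejection {h = zero} (false ∷ r) R E≤pu dn<E Dpu≡dn = ⊥-elim (no-down-at-0 R)
  after-rejection {pu} {dn} {suc h} (false ∷ r) R E≤pu dn<E Dpu≡dn =
    descents-cons-descent (L pu) (L dn) (canAux L (suc pu) (suc dn) r) (suc (peaks r))
      (L-descent (prev-up<n R) (dn<n R) (high≺low E≤pu dn<E Dpu≡dn (prev-up<n R)))
      (subst (λ q → length r ≤ desFrom dn (suc pu) (suc dn) r + q) (with-loss dn<E (peaks r))
        (past-E-down r (read-down R) (s≤s E≤pu)))

  rise-E-falling : ∀ {pd u h r} rest → Reading u (suc pd) h rest → E < u → r + suc pd ≡ E →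
                   accepts (falling h (suc r)) rest ≡ false → E ≡ riseStart (falling h (suc r)) E u rest →
                   length rest ≤ desFrom pd u (suc pd) rest + peaks (false ∷ rest)
  rise-E-falling [] _ _ _ _ _ = z≤n
  rise-E-falling {pd} {u} {r = zero} (true ∷ rest) R E<u pd+1≡E rejected E≡ =
    descents-cons-descent (L pd) (L u) (canAux L (suc u) (suc pd) rest) (peaks (true ∷ rest))
      (L-descent (prev-down<n R) (u<n R) (≺-valley (dn≤u R) (D-at-up R)))
      (subst (λ q → length rest ≤ desFrom u (suc u) (suc pd) rest + q) (without-loss (<-irrefl pd+1≡E) _)
        (past-E-up rest (read-up R) (<⇒≤ E<u)))
  rise-E-falling {pd} {u} {r = suc r} (true ∷ rest) R E<u r+pd+1≡E rejected E≡ =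
    descents-cons-descent (L pd) (L u) (canAux L (suc u) (suc pd) rest) (peaks (true ∷ rest))
      (L-descent (prev-down<n R) (u<n R) (≺-valley (dn≤u R) (D-at-up R)))
      (after-rejection rest (read-up R) (<⇒≤ E<u) (subst (suc pd <_) r+pd+1≡E (s≤s (m≤n+m (suc pd) r))) (D-at-up R))
  rise-E-falling {h = zero} (false ∷ rest) R _ _ _ _ = ⊥-elim (no-down-at-0 R)
  rise-E-falling {pd} {u} {suc h} {zero} (false ∷ rest) R E<u _ rejected E≡ =
    contradiction (subst (u ≤_) (sym E≡) (riseStart-settled h E u rest (rest-walk (read-down R)) rejected)) (<⇒≱ E<u)
  rise-E-falling {pd} {u} {suc h} {suc r} (false ∷ rest) R E<u r+pd+1≡E rejected E≡ =
    descents-cons-descent (L pd) (L (suc pd)) (canAux L u (suc (suc pd)) rest) (peaks (false ∷ rest))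
      (L-descent (prev-down<n R) (dn<n R) (≺-low-step (n<1+n pd) (subst (suc pd <_) r+pd+1≡E (m<n+m (suc pd) (s≤s z≤n)))))
      (rise-E-falling rest (read-down R) E<u (trans (+-suc r (suc pd)) r+pd+1≡E) rejected E≡)

  rise-E-rising : ∀ {pu dn v h} rest → Reading (suc pu) dn h rest → E ≤ pu → D pu ≡ dn → v + dn ≡ E →
                  accepts (rising v h) rest ≡ false → E ≡ riseStart (rising v h) E (suc pu) rest →
                  suc (length rest) ≤ desFrom pu (suc pu) dn rest + peaks (true ∷ rest)
  rise-E-rising {pu} {dn} {v} [] R E≤pu _ v+dn≡E _ _ =
    ⊥-elim (not-at-end R (≤-trans (subst (dn ≤_) v+dn≡E (m≤n+m dn v)) E≤pu) (n<1+n pu))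
  rise-E-rising {pu} {dn} (true ∷ r) R E≤pu _ v+dn≡E rejected E≡ =
    descents-cons-descent (L pu) (L (suc pu)) (canAux L (suc (suc pu)) dn r) (peaks (true ∷ r))
      (L-descent (prev-up<n R) (u<n R) (≺-high-step E≤pu (n<1+n pu)))
      (rise-E-rising r (read-up R) (≤-trans E≤pu (n≤1+n pu)) (D-at-up R) v+dn≡E rejected E≡)
  rise-E-rising {h = zero} (false ∷ r) R _ _ _ _ _ = ⊥-elim (no-down-at-0 R)
  rise-E-rising {pu} {dn} {zero} {suc h} (false ∷ r) R E≤pu _ _ rejected E≡ =
    contradiction (subst (suc pu ≤_) (sym E≡) (riseStart-settled h E (suc pu) r (rest-walk (read-down R)) rejected))
                  (<⇒≱ (s≤s E≤pu))
  rise-E-rising {pu} {dn} {suc v} {suc h} (false ∷ r) R E≤pu Dpu≡dn v+dn≡E rejected E≡ =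
    descents-cons-descent (L pu) (L dn) (canAux L (suc pu) (suc dn) r) (suc (peaks r))
      (L-descent (prev-up<n R) (dn<n R) (high≺low E≤pu dn<E Dpu≡dn (prev-up<n R)))
      (≤-+-suc (desFrom dn (suc pu) (suc dn) r) (peaks r)
        (rise-E-falling r (read-down R) (s≤s E≤pu) (trans (+-suc v dn) v+dn≡E) rejected E≡))
    where
    dn<E : dn < E
    dn<E = subst (dn <_) v+dn≡E (m<n+m dn (s≤s z≤n))

  mutual
    before-settled : ∀ {pd u h e} rest → Reading u (suc pd) h rest → accepts (falling h 0) rest ≡ false →
                     E ≡ riseStart (falling h 0) e u rest →
                     suc (length rest) ≤ desFrom pd u (suc pd) rest + peaks (false ∷ rest)
    before-settled [] R rejected _ with refl ← proj₂ (proj₂ (at-end R)) with () ← rejected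
    before-settled {pd} {u} {h} (true ∷ r) R rejected E≡ =
      descents-cons-descent (L pd) (L u) (canAux L (suc u) (suc pd) r) (peaks (true ∷ r))
        (L-descent (prev-down<n R) (u<n R) (≺-valley (dn≤u R) (D-at-up R)))
        (new-rise (riseStart-range (rising h (suc h)) u (suc u) r))
      where
      new-rise : riseStart (rising h (suc h)) u (suc u) r ≡ u ⊎ suc u ≤ riseStart (rising h (suc h)) u (suc u) r →
                 suc (length r) ≤ desFrom u (suc u) (suc pd) r + peaks (true ∷ r)
      new-rise (inj₁ E-here) =
        rise-E-rising r (read-up R) (≤-reflexive (trans E≡ E-here)) (D-at-up R)
          (trans (+-comm h (suc pd)) (trans (sym (height≡ R)) (sym (trans E≡ E-here)))) rejected
          (subst (λ e → E ≡ riseStart (rising h (suc h)) e (suc u) r) (sym (trans E≡ E-here)) E≡)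
      new-rise (inj₂ E-later) =
        before-rising r (read-up R) (n<1+n h) (λ E≡u → <-irrefl (sym E≡u) (subst (u <_) (sym E≡) E-later)) rejected E≡
    before-settled {h = zero} (false ∷ r) R _ _ = ⊥-elim (no-down-at-0 R)
    before-settled {pd} {u} {suc h} {e} (false ∷ r) R rejected E≡ =
      descents-cons-descent (L pd) (L (suc pd)) (canAux L u (suc (suc pd)) r) (peaks r)
        (L-descent (prev-down<n R) (dn<n R) (≺-low-step (n<1+n pd) (<-≤-trans (dn<u R) u≤E)))
        (before-settled r (read-down R) rejected E≡)
      where
      u≤E : u ≤ E
      u≤E = subst (u ≤_) (sym E≡) (riseStart-settled (suc h) e u (false ∷ r) (rest-walk R) rejected)

    before-rising : ∀ {pu dn v h e} rest → Reading (suc pu) dn h rest → v < h → E ≢ e →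
                    accepts (rising v h) rest ≡ false → E ≡ riseStart (rising v h) e (suc pu) rest →
                    suc (length rest) ≤ desFrom pu (suc pu) dn rest + peaks (true ∷ rest)
    before-rising [] R v<h _ _ _ with refl ← proj₂ (proj₂ (at-end R)) with () ← v<h
    before-rising {pu} {dn} {v} {h} {e} (true ∷ r) R v<h E≢e rejected E≡
      with riseStart-range (rising v (suc h)) e (suc (suc pu)) r
    ... | inj₁ E-here  = contradiction (trans E≡ E-here) E≢e
    ... | inj₂ E-later =
      descents-cons-descent (L pu) (L (suc pu)) (canAux L (suc (suc pu)) dn r) (peaks (true ∷ r))
        (L-descent (prev-up<n R) (u<n R) (≺-low-step (n<1+n pu) (subst (suc pu <_) (sym E≡) E-later)))
        (before-rising r (read-up R) (≤-trans v<h (n≤1+n h)) E≢e rejected E≡)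
    before-rising {h = zero} (false ∷ r) R _ _ _ _ = ⊥-elim (no-down-at-0 R)
    before-rising {pu} {dn} {zero} {suc h} (false ∷ r) R _ _ rejected E≡ =
      descents-cons-≥ (L pu) (L dn) (canAux L (suc pu) (suc dn) r) (suc (peaks r))
        (≤-+-suc (desFrom dn (suc pu) (suc dn) r) (peaks r) (before-settled r (read-down R) rejected E≡))
    before-rising {pu} {dn} {suc v} {suc h} (false ∷ r) R v<h E≢e rejected E≡ =
      descents-cons-≥ (L pu) (L dn) (canAux L (suc pu) (suc dn) r) (suc (peaks r))
        (≤-+-suc (desFrom dn (suc pu) (suc dn) r) (peaks r) (before-falling r (read-down R) (≤-pred v<h) E≢e rejected E≡))

    before-falling : ∀ {pd u h r e} rest → Reading u (suc pd) h rest → suc r ≤ h → E ≢ e →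
                     accepts (falling h (suc r)) rest ≡ false → E ≡ riseStart (falling h (suc r)) e u rest →
                     suc (length rest) ≤ desFrom pd u (suc pd) rest + peaks (false ∷ rest)
    before-falling [] R r<h _ _ _ with refl ← proj₂ (proj₂ (at-end R)) with () ← r<h
    before-falling (true ∷ _) R _ E≢e _ E≡ = contradiction E≡ E≢e
    before-falling {h = zero} (false ∷ rest) R _ _ _ _ = ⊥-elim (no-down-at-0 R)
    before-falling {pd} {u} {suc h} {r} {e} (false ∷ rest) R r<h E≢e rejected E≡
      with riseStart-range (falling (suc h) (suc r)) e u (false ∷ rest)
    ... | inj₁ E-here = contradiction (trans E≡ E-here) E≢e
    ... | inj₂ u≤E =
      descents-cons-descent (L pd) (L (suc pd)) (canAux L u (suc (suc pd)) rest) (peaks rest)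
        (L-descent (prev-down<n R) (dn<n R) (≺-low-step (n<1+n pd) (<-≤-trans (dn<u R) (subst (u ≤_) (sym E≡) u≤E))))
        (continue r (≤-pred r<h) rejected E≡)
      where
      continue : ∀ r → r ≤ h → accepts (step (falling (suc h) (suc r)) false) rest ≡ false →
                 E ≡ riseStart (step (falling (suc h) (suc r)) false) e u rest →
                 suc (length rest) ≤ desFrom (suc pd) u (suc (suc pd)) rest + peaks (false ∷ rest)
      continue zero    _   rejected′ E≡′ = before-settled rest (read-down R) rejected′ E≡′
      continue (suc r) r<h rejected′ E≡′ = before-falling rest (read-down R) r<h E≢e rejected′ E≡′

  lower-bound : ∀ rest → Reading 0 0 0 rest → accepts (falling 0 0) rest ≡ false →
                E ≡ riseStart (falling 0 0) 0 0 rest → length rest ≤ descents (canAux L 0 0 rest) + peaks rest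
  lower-bound (true ∷ r) R rejected E≡ with riseStart-range (rising 0 1) 0 1 r
  ... | inj₁ E-here  =
    rise-E-rising r (read-up R) (≤-reflexive (trans E≡ E-here)) (D-at-up R) (sym (trans E≡ E-here)) rejected
      (subst (λ e → E ≡ riseStart (rising 0 1) e 1 r) (sym (trans E≡ E-here)) E≡)
  ... | inj₂ E-later =
    before-rising r (read-up R) (s≤s z≤n) (λ E≡0 → <-irrefl (sym E≡0) (subst (1 ≤_) (sym E≡) E-later)) rejected E≡
  lower-bound (false ∷ r) R _ _ = ⊥-elim (no-down-at-0 R)

-- When the decreasing permutation is optimal

module _ {n : ℕ} (d : DyckPath n) where
  private
    w = steps d
    reading : Scan.Reading w n 0 0 0 w
    reading = Scan.start w n (dyckOK d) (downs≡semilength d)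

  des-δ+pk : des d (δ n) + pk d ≡ length w ∸ 1
  des-δ+pk = trans (cong (λ c → descents c + pk d) (canAux-cong (label-δ n) 0 0 w))
                   (DecreasingLabels.des+peaks≡ w n w reading)

  des+bpk≤ : ∀ σ → des d σ + bpk d ≤ length w ∸ 1
  des+bpk≤ σ = UpperBound.des+bounces≤ w n (label σ) w reading
                 (subst (λ m → Bounces m (upsBefore w) 0 (bpk d)) (downs≡semilength d) (BouncePath.bpk-bounces w (dyckOK d)))

  rejected⇒beats-δ : accepts (falling 0 0) w ≡ false → ∃ λ σ → length w ≤ des d σ + pk d
  rejected⇒beats-δ rejected = σ , subst (λ L → length w ≤ descents (canAux L 0 0 w) + pk d) L≡label
                                        (lower-bound w reading rejected refl)
    where open LowerBound w n

  pk≡bpk⇒δ∈M : pk d ≡ bpk d → InM d (δ n)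
  pk≡bpk⇒δ∈M pk≡bpk σ = +-cancelʳ-≤ (bpk d) (des d σ) (des d (δ n)) (begin
    des d σ + bpk d       ≤⟨ des+bpk≤ σ ⟩
    length w ∸ 1          ≡⟨ sym des-δ+pk ⟩
    des d (δ n) + pk d    ≡⟨ cong (λ p → des d (δ n) + p) pk≡bpk ⟩
    des d (δ n) + bpk d   ∎)
    where open ≤-Reasoning

  δ∈M⇒pk≡bpk : InM d (δ n) → pk d ≡ bpk d
  δ∈M⇒pk≡bpk δ∈M with accepts (falling 0 0) w in verdict
  ... | true  = proj₁ (bounce-verdict w (dyckOK d)) verdict
  ... | false = contradiction (rejected-nonempty w verdict) (≤⇒≯ (begin
    length w              ≤⟨ proj₂ (rejected⇒beats-δ verdict) ⟩
    des d σ + pk d        ≤⟨ +-monoˡ-≤ (pk d) (δ∈M σ) ⟩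
    des d (δ n) + pk d    ≡⟨ des-δ+pk ⟩
    length w ∸ 1          ∎))
    where
    open ≤-Reasoning
    σ = proj₁ (rejected⇒beats-δ verdict)

-- Counting the paths with pk = bpk

walk-height≤length : ∀ {h} w → walk h w ≡ just 0 → h ≤ length w
walk-height≤length {h} w e = begin
  h                   ≤⟨ m≤m+n h (ups w) ⟩
  h + ups w           ≡⟨ walk-balance h w e ⟩
  downs w             ≤⟨ m≤n+m (downs w) (ups w) ⟩
  ups w + downs w     ≡⟨ sym (length≡ups+downs w) ⟩
  length w            ∎
  where open ≤-Reasoning

words-length : ∀ L → All (λ w → length w ≡ L) (words L)
words-length zero    = refl ∷ []
words-length (suc L) = ++⁺ (map⁺ (All.map (cong suc) (words-length L))) (map⁺ (All.map (cong suc) (words-length L)))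

accepted? : (s : State) → Decidable (λ w → accepts s w ≡ true)
accepted? s w = accepts s w Bool.≟ true

#accepted : State → ℕ → ℕ
#accepted s L = length (filter (accepted? s) (words L))

length-filter-map : ∀ s x ws →
                    length (filter (accepted? s) (map (x ∷_) ws)) ≡ length (filter (accepted? (step s x)) ws)
length-filter-map s x []       = refl
length-filter-map s x (w ∷ ws) with accepts (step s x) w Bool.≟ true
... | yes _ = cong suc (length-filter-map s x ws)
... | no  _ = length-filter-map s x ws

#accepted-suc : ∀ s L → #accepted s (suc L) ≡ #accepted (step s true) L + #accepted (step s false) L
#accepted-suc s L = begin
  length (filter (accepted? s) (map (true ∷_) (words L) ++ map (false ∷_) (words L)))
    ≡⟨ cong length (filter-++ (accepted? s) (map (true ∷_) (words L)) _) ⟩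
  length (filter (accepted? s) (map (true ∷_) (words L)) ++ filter (accepted? s) (map (false ∷_) (words L)))
    ≡⟨ length-++ (filter (accepted? s) (map (true ∷_) (words L))) ⟩
  length (filter (accepted? s) (map (true ∷_) (words L))) + length (filter (accepted? s) (map (false ∷_) (words L)))
    ≡⟨ cong₂ _+_ (length-filter-map s true (words L)) (length-filter-map s false (words L)) ⟩
  #accepted (step s true) L + #accepted (step s false) L
    ∎
  where open ≡-Reasoning

#accepted-dead : ∀ L → #accepted dead L ≡ 0
#accepted-dead L = cong length (filter-none (accepted? dead) (All.universal dead-rejects′ (words L)))
  where
  dead-rejects′ : ∀ w → accepts dead w ≢ true
  dead-rejects′ w a with () ← trans (sym a) (dead-rejects w)

#accepted-short : ∀ s L → L < level s → #accepted s L ≡ 0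
#accepted-short s L L<level = cong length (filter-none (accepted? s) (All.map (λ {w} → too-short {w}) (words-length L)))
  where
  too-short : ∀ {w} → length w ≡ L → accepts s w ≢ true
  too-short {w} refl a = <⇒≱ L<level (walk-height≤length w (accepts⇒walk s w a))

-- fibOdd m = F (2m − 1) and fibEven m = F (2m) for the Fibonacci numbers F, with F (−1) = 1.
mutual
  fibOdd : ℕ → ℕ
  fibOdd zero    = 1
  fibOdd (suc m) = fibOdd m + fibEven m

  fibEven : ℕ → ℕ
  fibEven zero    = 0
  fibEven (suc m) = fibEven m + fibOdd (suc m)

fallingCount : ℕ → ℕ → ℕ
fallingCount d zero    = 1
fallingCount d (suc m) = suc d * fibOdd (suc m)

private
  rise-length : ∀ m h → m + suc m + h ≡ m + m + suc h
  rise-length = solve-∀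

  fall-length : ∀ m h → m + suc m + suc h ≡ suc m + suc m + h
  fall-length = solve-∀

  falling-identity : ∀ x y c → x + 1 * y + c * (x + y) ≡ suc c * (x + y)
  falling-identity = solve-∀

  rising-identity : ∀ x y a → x + (2 + a) * y + suc a * (x + y) ≡ (x + y) + suc a * (y + (x + y))
  rising-identity = solve-∀

  too-short : ∀ {L h} → L ≡ h → L < 2 + h
  too-short refl = n≤1+n _

mutual
  #accepted-falling : ∀ L m h r → r ≤ h → L ≡ m + m + h → #accepted (falling h r) L ≡ fallingCount (h ∸ r) m
  #accepted-falling zero    zero    zero    zero    _   refl = refl
  #accepted-falling (suc L) m       (suc h) (suc r) (s≤s r≤h) e =
    trans (#accepted-suc (falling (suc h) (suc r)) L)
          (cong₂ _+_ (#accepted-dead L) (#accepted-falling L m h r r≤h (suc-injective (trans e (+-suc (m + m) h)))))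
  #accepted-falling (suc L) zero    (suc h) zero    _   e =
    trans (#accepted-suc (falling (suc h) zero) L)
          (cong₂ _+_ (#accepted-short (rising (suc h) (suc (suc h))) L (too-short (suc-injective e)))
                     (#accepted-falling L zero h zero z≤n (suc-injective e)))
  #accepted-falling (suc L) (suc m) zero    zero    _   e =
    trans (#accepted-suc (falling zero zero) L)
          (trans (cong₂ _+_ (#accepted-rising L m zero 1 ≤-refl (trans (suc-injective e) (rise-length m 0))) (#accepted-dead L))
                 (falling-identity (fibOdd m) (fibEven m) 0))
  #accepted-falling (suc L) (suc m) (suc h) zero    _   e = begin
    #accepted (falling (suc h) zero) (suc L)
      ≡⟨ #accepted-suc (falling (suc h) zero) L ⟩
    #accepted (rising (suc h) (suc (suc h))) L + #accepted (falling h zero) L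
      ≡⟨ cong₂ _+_ (#accepted-rising L m (suc h) (suc (suc h)) ≤-refl (trans L≡ (rise-length m (suc h))))
                   (#accepted-falling L (suc m) h zero z≤n (trans L≡ (fall-length m h))) ⟩
    fibOdd m + (suc (suc h) ∸ suc h) * fibEven m + suc h * fibOdd (suc m)
      ≡⟨ cong (λ d → fibOdd m + d * fibEven m + suc h * fibOdd (suc m)) (m+n∸n≡m 1 h) ⟩
    fibOdd m + 1 * fibEven m + suc h * fibOdd (suc m)
      ≡⟨ falling-identity (fibOdd m) (fibEven m) (suc h) ⟩
    suc (suc h) * fibOdd (suc m)
      ∎
    where
    open ≡-Reasoning
    L≡ = suc-injective e

  #accepted-rising : ∀ L m v h → v < h → L ≡ m + m + h → #accepted (rising v h) L ≡ fibOdd m + (h ∸ v) * fibEven m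
  #accepted-rising (suc L) zero    v (suc h) (s≤s v≤h) e =
    trans (#accepted-suc (rising v (suc h)) L)
          (trans (cong₂ _+_ (#accepted-short (rising v (suc (suc h))) L (too-short (suc-injective e)))
                            (#accepted-falling L zero h v v≤h (suc-injective e)))
                 (cong suc (sym (*-zeroʳ (suc h ∸ v)))))
  #accepted-rising (suc L) (suc m) v (suc h) (s≤s v≤h) e = begin
    #accepted (rising v (suc h)) (suc L)
      ≡⟨ #accepted-suc (rising v (suc h)) L ⟩
    #accepted (rising v (suc (suc h))) L + #accepted (falling h v) L
      ≡⟨ cong₂ _+_ (#accepted-rising L m v (suc (suc h)) (≤-trans (s≤s v≤h) (n≤1+n _)) (trans L≡ (rise-length m (suc h))))
                   (#accepted-falling L (suc m) h v v≤h (trans L≡ (fall-length m h))) ⟩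
    fibOdd m + (2 + h ∸ v) * fibEven m + suc (h ∸ v) * fibOdd (suc m)
      ≡⟨ cong (λ d → fibOdd m + d * fibEven m + suc (h ∸ v) * fibOdd (suc m)) (+-∸-assoc 2 v≤h) ⟩
    fibOdd m + (2 + (h ∸ v)) * fibEven m + suc (h ∸ v) * fibOdd (suc m)
      ≡⟨ rising-identity (fibOdd m) (fibEven m) (h ∸ v) ⟩
    fibOdd (suc m) + suc (h ∸ v) * fibEven (suc m)
      ≡⟨ cong (λ d → fibOdd (suc m) + d * fibEven (suc m)) (sym (+-∸-assoc 1 v≤h)) ⟩
    fibOdd (suc m) + (suc h ∸ v) * fibEven (suc m)
      ∎
    where
    open ≡-Reasoning
    L≡ = suc-injective e

good⇒accepted : ∀ w → Good w → accepts (falling 0 0) w ≡ true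
good⇒accepted w (isDyck , pk≡bpk) with accepts (falling 0 0) w in eq
... | true  = refl
... | false = contradiction (proj₂ (bounce-verdict w isDyck) eq) (<-irrefl (sym pk≡bpk))

accepted⇒good : ∀ w → accepts (falling 0 0) w ≡ true → Good w
accepted⇒good w a = isDyck , proj₁ (bounce-verdict w isDyck) a
  where
  isDyck = accepts⇒walk (falling 0 0) w a

good≐accepted : Good ≐ (λ w → accepts (falling 0 0) w ≡ true)
good≐accepted = (λ {w} → good⇒accepted w) , (λ {w} → accepted⇒good w)

a≡fibOdd : ∀ k → a k ≡ fibOdd k
a≡fibOdd k = begin
  a k                               ≡⟨ cong length (filter-≐ good? (accepted? (falling 0 0)) good≐accepted (words (2 * k))) ⟩
  #accepted (falling 0 0) (2 * k)   ≡⟨ #accepted-falling (2 * k) k 0 0 z≤n (trans (double k) (sym (+-identityʳ (k + k)))) ⟩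
  fallingCount 0 k                  ≡⟨ fallingCount-0 k ⟩
  fibOdd k                          ∎
  where
  open ≡-Reasoning
  fallingCount-0 : ∀ k → fallingCount 0 k ≡ fibOdd k
  fallingCount-0 zero    = refl
  fallingCount-0 (suc k) = *-identityˡ (fibOdd (suc k))

fibOdd-recurrence : ∀ m → fibOdd (2 + m) + fibOdd m ≡ 3 * fibOdd (1 + m)
fibOdd-recurrence m = identity (fibOdd m) (fibEven m)
  where
  identity : ∀ x y → (x + y) + (y + (x + y)) + x ≡ 3 * (x + y)
  identity = solve-∀

-- The generating function

sumTo-cong : ∀ m {f f′ : ℕ → ℤ} → (∀ k → f k ≡ f′ k) → sumTo m f ≡ sumTo m f′
sumTo-cong zero    f≗f′ = f≗f′ 0
sumTo-cong (suc m) f≗f′ = cong₂ ℤ._+_ (sumTo-cong m f≗f′) (f≗f′ (suc m))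

sumTo-vanishing-tail : ∀ j (f : ℕ → ℤ) → (∀ i → f (3 + i) ≡ + 0) → sumTo (2 + j) f ≡ sumTo 2 f
sumTo-vanishing-tail zero    f _     = refl
sumTo-vanishing-tail (suc j) f tail0 =
  trans (cong (λ x → sumTo (2 + j) f ℤ.+ x) (tail0 j)) (trans (ℤ.+-identityʳ _) (sumTo-vanishing-tail j f tail0))

three-term : ∀ x y z → + 1 ℤ.* x ℤ.+ ℤ.- (+ 3) ℤ.* y ℤ.+ + 1 ℤ.* z ≡ (x ℤ.+ z) ℤ.- + 3 ℤ.* y
three-term = ℤ-Solver.solve-∀

fibOdd-conv : ∀ n → conv den (λ k → + fibOdd k) n ≡ num n
fibOdd-conv 0 = refl
fibOdd-conv 1 = refl
fibOdd-conv 2 = refl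
fibOdd-conv (suc (suc (suc k))) = begin
  conv den (λ k → + fibOdd k) (3 + k)
    ≡⟨ sumTo-vanishing-tail (1 + k) _ (λ i → ℤ.*-zeroˡ (+ fibOdd (k ∸ i))) ⟩
  + 1 ℤ.* + A ℤ.+ ℤ.- (+ 3) ℤ.* + B ℤ.+ + 1 ℤ.* + C
    ≡⟨ three-term (+ A) (+ B) (+ C) ⟩
  (+ A ℤ.+ + C) ℤ.- + 3 ℤ.* + B
    ≡⟨ cong₂ ℤ._-_ (sym (ℤ.pos-+ A C)) (sym (ℤ.pos-* 3 B)) ⟩
  + (A + C) ℤ.- + (3 * B)
    ≡⟨ cong (λ x → + x ℤ.- + (3 * B)) (fibOdd-recurrence (1 + k)) ⟩
  + (3 * B) ℤ.- + (3 * B)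
    ≡⟨ ℤ.+-inverseʳ (+ (3 * B)) ⟩
  + 0
    ∎
  where
  open ≡-Reasoning
  A = fibOdd (3 + k)
  B = fibOdd (2 + k)
  C = fibOdd (1 + k)

generating-function : ∀ n → conv den (λ k → + a k) n ≡ num n
generating-function n = trans (sumTo-cong n (λ k → cong (λ x → den k ℤ.* + x) (a≡fibOdd (n ∸ k)))) (fibOdd-conv n)

corollary4p3 : ((n : ℕ) (d : DyckPath n) → (InM d (δ n) ⇔ (pk d ≡ bpk d)))
    × ((n : ℕ) → conv den (λ k → + a k) n ≡ num n)
corollary4p3 = (λ n d → mk⇔ (δ∈M⇒pk≡bpk d) (pk≡bpk⇒δ∈M d)) , generating-function
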